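{- Let $q$ be a prime power, $n\ge 1$, and let $V$ be an $(n+1)$-dimensional vector space over $\mathbb F_q$ with dual $V^*$. Let $\Lambda_1$ be the set of points of $\mathrm{PG}(V\otimes V^*)$ represented by the pure tensors $x\otimes\xi$ with $0\neq x\in V$, $0\neq\xi\in V^*$ and $\xi(x)=0$. Then the linear code $\mathcal C(\Lambda_1)$ associated to the projective system $\Lambda_1$ is an $[N_1,k_1,d_1]$-code with \[N_1=\frac{(q^{n+1}-1)(q^n-1)}{(q-1)^2},\qquad k_1=n^2+2n,\qquad d_1=q^{2n-1}-q^{n-1}.\]
   Context: For a spanning set $\Omega=\{[v_1],\dots,[v_N]\}$ of $N$ distinct points of a finite projective space $\mathrm{PG}(W)$ (a projective system), the code $\mathcal C(\Omega)$ is the $\mathbb F_q$-linear code of length $N$ whose generator matrix has as columns the coordinate vectors of fixed representatives $v_1,\dots,v_N$; it is well defined up to monomial equivalence. Here $\Lambda_1$ is viewed as a projective system of the subspace it spans. $[v]$ denotes the projective point spanned by a nonzero vector $v$. -}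

module Defs where

open import Level using (Level; _⊔_)
open import Data.Nat using (ℕ; zero; suc; _^_; _≤_)
open import Data.Nat.Primality using (Prime)
open import Data.Fin using (Fin; zero; suc)
open import Data.Product using (Σ; ∃; _×_; _,_)
open import Relation.Nullary using (¬_; yes; no)
open import Relation.Binary using (Decidable)
open import Relation.Binary.PropositionalEquality using (_≡_; _≢_)
import Relation.Binary.PropositionalEquality as ≡
open import Function.Bundles using (Inverse)
open import Algebra.Bundles using (CommutativeRing)

IsPrimePower : ℕ → Set
IsPrimePower q = Σ ℕ λ p → Σ ℕ λ k → Prime p × q ≡ p ^ suc k

module _ {c ℓ : Level} (F : CommutativeRing c ℓ) where
  open CommutativeRing F using (Carrier; _≈_; _+_; _*_; 0#; 1#; setoid)

  IsField : Set (c ⊔ ℓ)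
  IsField = (¬ (1# ≈ 0#)) × (∀ x → ¬ (x ≈ 0#) → Σ Carrier λ y → x * y ≈ 1#)

  HasCard : ℕ → Set (c ⊔ ℓ)
  HasCard q = Inverse (≡.setoid (Fin q)) setoid

  Σᶠ : ∀ {k} → (Fin k → Carrier) → Carrier
  Σᶠ {zero} f = 0#
  Σᶠ {suc k} f = f zero + Σᶠ (λ i → f (suc i))

  Vect : ℕ → Set c
  Vect k = Fin k → Carrier

  _≈ᵥ_ : ∀ {k} → Vect k → Vect k → Set ℓ
  u ≈ᵥ v = ∀ i → u i ≈ v i

  NonZeroV : ∀ {k} → Vect k → Set ℓ
  NonZeroV {k} v = Σ (Fin k) λ i → ¬ (v i ≈ 0#)

  -- V = F^m, V* = F^m (dual coordinates), V ⊗ V* = m×m arrays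
  Tens : ℕ → Set c
  Tens m = Fin m → Fin m → Carrier

  _≈ₜ_ : ∀ {m} → Tens m → Tens m → Set ℓ
  A ≈ₜ B = ∀ i j → A i j ≈ B i j

  _⊗_ : ∀ {m} → Vect m → Vect m → Tens m
  (x ⊗ ξ) i j = x i * ξ j

  eval : ∀ {m} → Vect m → Vect m → Carrier
  eval ξ x = Σᶠ (λ i → ξ i * x i)

  InΛ₁ : ∀ {m} → Tens m → Set (c ⊔ ℓ)
  InΛ₁ {m} A = Σ (Vect m) λ x → Σ (Vect m) λ ξ →
    NonZeroV x × NonZeroV ξ × (eval ξ x ≈ 0#) × (A ≈ₜ (x ⊗ ξ))

  SamePoint : ∀ {m} → Tens m → Tens m → Set (c ⊔ ℓ)
  SamePoint A B = Σ Carrier λ λ' → ¬ (λ' ≈ 0#) × (A ≈ₜ (λ i j → λ' * B i j))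

  -- reps : Fin N → V⊗V* is a list of representatives of the N distinct points of Λ₁
  IsRepsΛ₁ : ∀ {m N} → (Fin N → Tens m) → Set (c ⊔ ℓ)
  IsRepsΛ₁ {m} {N} reps =
    (∀ k → InΛ₁ (reps k)) ×
    (∀ k l → k ≢ l → ¬ SamePoint (reps k) (reps l)) ×
    (∀ A → InΛ₁ A → Σ (Fin N) λ k → SamePoint A (reps k))

  -- codeword of the code C(Ω) given by the linear functional U on V⊗V*
  -- (coordinates: the pairing ⟨U,A⟩ = Σ_{ij} U_ij A_ij); these are exactly
  -- the elements of the row space of the generator matrix
  codeword : ∀ {m N} → (Fin N → Tens m) → Tens m → Vect N
  codeword reps U k = Σᶠ (λ i → Σᶠ (λ j → U i j * reps k i j))

  InCode : ∀ {m N} → (Fin N → Tens m) → Vect N → Set (c ⊔ ℓ)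
  InCode {m} reps w = Σ (Tens m) λ U → w ≈ᵥ codeword reps U

  lincomb : ∀ {k N} → Vect k → (Fin k → Vect N) → Vect N
  lincomb a b j = Σᶠ (λ i → a i * b i j)

  HasDim : ∀ {N} → (Vect N → Set (c ⊔ ℓ)) → ℕ → Set (c ⊔ ℓ)
  HasDim {N} S k = Σ (Fin k → Vect N) λ b →
    (∀ i → S (b i)) ×
    (∀ a → (∀ j → lincomb a b j ≈ 0#) → ∀ i → a i ≈ 0#) ×
    (∀ w → S w → Σ (Vect k) λ a → w ≈ᵥ lincomb a b)

  wt : Decidable _≈_ → ∀ {N} → Vect N → ℕ
  wt dec {zero} w = 0
  wt dec {suc N} w with dec (w zero) 0#
  ... | yes _ = wt dec (λ i → w (suc i))
  ... | no _ = suc (wt dec (λ i → w (suc i)))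

  HasMinDist : Decidable _≈_ → ∀ {N} → (Vect N → Set (c ⊔ ℓ)) → ℕ → Set (c ⊔ ℓ)
  HasMinDist dec {N} S d =
    (Σ (Vect N) λ w → S w × NonZeroV w × wt dec w ≡ d) ×
    (∀ w → S w → NonZeroV w → d ≤ wt dec w)

{-# OPTIONS --safe #-}
-- A flag is a pair (x, ξ) of nonzero vectors with ξ(x) = 0. Every flag represents exactly one
-- point [x ⊗ ξ] of Λ₁ and every point is represented by (q - 1)² flags; counting flags gives N.
--
-- Up to nonzero scalars, the codeword of a matrix U takes the value ξ(Ux) at [x ⊗ ξ], so its weight
-- times (q - 1)² is the number of flags with ξ(Ux) ≠ 0. For fixed x that number is 0 when Ux ∈ ⟨x⟩
-- and q^n - q^(n-1) otherwise, so the weight is determined by the number D of such x. For U not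
-- scalar, D ≤ q^n + q - 1: if λ is an eigenvalue, these x lie in ker(U - λ) ∪ im(U - λ), two sets
-- of sizes K, I ≥ q with K · I = q^(n+1). The rank-one matrix e₀ ⊗ e₀ attains the bound, which
-- gives d₁ = (q^n - 1) q^(n-1).
--
-- A matrix pairing to zero with all of Λ₁ kills every flag and is therefore scalar, so U ↦ codeword
-- has the scalar matrices as kernel, and the codewords of the matrix units other than E₀₀ form a
-- basis: k₁ = (n + 1)² - 1.
module Submission where

open import Defs
open import Level using (Level; _⊔_)
open import Data.Nat as ℕ using (ℕ; zero; suc; _∸_; _^_; _≤_; _<_; z≤n; s≤s; NonZero)
import Data.Nat.Properties as ℕP
open import Data.Nat.Tactic.RingSolver using (solve-∀)
open import Data.Fin as Fin using (Fin; zero; suc)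
import Data.Fin.Properties as FinP
open import Data.Fin.Permutation using (Permutation; permutation)
open import Data.Vec.Functional using (_∷_; tail)
open import Data.Product using (Σ; ∃; _×_; _,_; proj₁; proj₂; uncurry)
open import Data.Sum using (_⊎_; inj₁; inj₂)
open import Data.Empty using (⊥-elim)
open import Data.Unit using (⊤; tt)
open import Function.Bundles using (Inverse)
open import Relation.Nullary using (¬_; Dec; yes; no; ¬?; _×-dec_; _⊎-dec_)
open import Relation.Nullary.Decidable using (decidable-stable)
open import Relation.Unary as U using (Pred; _⊆_)
open import Relation.Unary.Properties using (U?; _∩?_; _∪?_; ∁?)
open import Relation.Binary using (Decidable; _Respects_)
open import Relation.Binary.PropositionalEquality as ≡ using (_≡_; _≢_)
open import Algebra.Bundles using (CommutativeRing)
import Algebra.Properties.Semiring.Sum as SemiringSum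
import Algebra.Properties.Ring as RingProperties
import Algebra.Properties.CommutativeSemigroup as CommutativeSemigroupProperties
import Data.Vec.Functional.Relation.Binary.Equality.Setoid as PointwiseEquality
import Relation.Binary.Reasoning.Setoid as SetoidReasoning

module ℕΣ = SemiringSum ℕP.+-*-semiring
open ℕΣ using (sum)

module Arithmetic where

  open import Data.Nat using (_+_; _*_)

  m*n≡q*p⇒m+n≤p+q : ∀ {q m n p} → 0 < q → q ≤ m → q ≤ n → m * n ≡ q * p → m + n ≤ p + q
  m*n≡q*p⇒m+n≤p+q {q} {m} {n} {p} 0<q q≤m q≤n mn≡qp
    with a , ≡.refl ← ℕP.m≤n⇒∃[o]m+o≡n q≤m | b , ≡.refl ← ℕP.m≤n⇒∃[o]m+o≡n q≤n = begin
      q + a + (q + b)  ≡⟨ shuffle q a b ⟩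
      q + a + b + q    ≤⟨ ℕP.+-monoˡ-≤ q (ℕP.*-cancelˡ-≤ q ⦃ ℕ.>-nonZero 0<q ⦄ q[q+a+b]≤qp) ⟩
      p + q            ∎
    where
    open ℕP.≤-Reasoning
    shuffle : ∀ q a b → q + a + (q + b) ≡ q + a + b + q
    shuffle = solve-∀
    expand : ∀ q a b → (q + a) * (q + b) ≡ q * (q + a + b) + a * b
    expand = solve-∀
    q[q+a+b]≤qp : q * (q + a + b) ≤ q * p
    q[q+a+b]≤qp = begin
      q * (q + a + b)          ≤⟨ ℕP.m≤m+n _ (a * b) ⟩
      q * (q + a + b) + a * b  ≡⟨ expand q a b ⟨
      (q + a) * (q + b)        ≡⟨ mn≡qp ⟩
      q * p                    ∎

  m+1≡n⇒m≡n∸1 : ∀ {m n} → m + 1 ≡ n → m ≡ n ∸ 1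
  m+1≡n⇒m≡n∸1 {m} ≡.refl = ≡.sym (ℕP.m+n∸n≡m m 1)

  q^[2n∸1]∸q^[n∸1]≡[q^n∸1]*q^[n∸1] : ∀ q n → q ^ (2 * n ∸ 1) ∸ q ^ (n ∸ 1) ≡ (q ^ n ∸ 1) * q ^ (n ∸ 1)
  q^[2n∸1]∸q^[n∸1]≡[q^n∸1]*q^[n∸1] q zero    = ≡.refl
  q^[2n∸1]∸q^[n∸1]≡[q^n∸1]*q^[n∸1] q (suc k) = begin
    q ^ (k + (suc k + 0)) ∸ q ^ k
      ≡⟨ ≡.cong (λ e → q ^ (k + e) ∸ q ^ k) (ℕP.+-identityʳ (suc k)) ⟩
    q ^ (k + suc k) ∸ q ^ k
      ≡⟨ ≡.cong (_∸ q ^ k) (ℕP.^-distribˡ-+-* q k (suc k)) ⟩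
    q ^ k * q ^ suc k ∸ q ^ k
      ≡⟨ ≡.cong₂ _∸_ (ℕP.*-comm (q ^ suc k) (q ^ k)) (ℕP.*-identityˡ (q ^ k)) ⟨
    q ^ suc k * q ^ k ∸ 1 * q ^ k
      ≡⟨ ℕP.*-distribʳ-∸ (q ^ k) (q ^ suc k) 1 ⟨
    (q ^ suc k ∸ 1) * q ^ k ∎
    where open ≡.≡-Reasoning

  -- With t = q - 1 and q · P = R + 1, rows gives w · t = c · P and split gives c ≥ t · R.
  module WeightArithmetic {t P w c D : ℕ} .⦃ _ : NonZero t ⦄
    (rows : w * (t * t) + c * P ≡ c * (suc t * P)) where

    open ℕP.≤-Reasoning

    private
      rearrange : ∀ R P t → R * P * t ≡ t * R * P
      rearrange = solve-∀

    w*t≡c*P : w * t ≡ c * P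
    w*t≡c*P = ℕP.*-cancelʳ-≡ (w * t) (c * P) t (begin-equality
      w * t * t    ≡⟨ ℕP.*-assoc w t t ⟩
      w * (t * t)  ≡⟨ ℕP.+-cancelʳ-≡ (c * P) _ _ (≡.trans rows (split c t P)) ⟩
      c * P * t    ∎)
      where
      split : ∀ c t P → c * (suc t * P) ≡ c * P * t + c * P
      split = solve-∀

    module _ {R : ℕ} (split : c + D ≡ suc t * suc R) where

      c+[D+1]≡t*R+[1+R+1+t] : c + (D + 1) ≡ t * R + (suc R + suc t)
      c+[D+1]≡t*R+[1+R+1+t] = begin-equality
        c + (D + 1)                ≡⟨ ℕP.+-assoc c D 1 ⟨
        c + D + 1                  ≡⟨ ≡.cong (_+ 1) split ⟩
        suc t * suc R + 1          ≡⟨ expand t R ⟩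
        t * R + (suc R + suc t)    ∎
        where
        expand : ∀ t R → suc t * suc R + 1 ≡ t * R + (suc R + suc t)
        expand = solve-∀

      R*P≤w : D + 1 ≤ suc R + suc t → R * P ≤ w
      R*P≤w D+1≤ = ℕP.*-cancelʳ-≤ (R * P) w t (begin
        R * P * t  ≡⟨ rearrange R P t ⟩
        t * R * P  ≤⟨ ℕP.*-monoˡ-≤ P t*R≤c ⟩
        c * P      ≡⟨ w*t≡c*P ⟨
        w * t      ∎)
        where
        t*R≤c : t * R ≤ c
        t*R≤c = ℕP.+-cancelʳ-≤ (suc R + suc t) (t * R) c (begin
          t * R + (suc R + suc t)  ≡⟨ c+[D+1]≡t*R+[1+R+1+t] ⟨
          c + (D + 1)              ≤⟨ ℕP.+-monoʳ-≤ c D+1≤ ⟩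
          c + (suc R + suc t)      ∎)

      R*P≡w : D + 1 ≡ suc R + suc t → R * P ≡ w
      R*P≡w D+1≡ = ℕP.*-cancelʳ-≡ (R * P) w t (begin-equality
        R * P * t  ≡⟨ rearrange R P t ⟩
        t * R * P  ≡⟨ ≡.cong (_* P) t*R≡c ⟩
        c * P      ≡⟨ w*t≡c*P ⟨
        w * t      ∎)
        where
        t*R≡c : t * R ≡ c
        t*R≡c = ℕP.+-cancelʳ-≡ (suc R + suc t) (t * R) c
          (≡.trans (≡.sym c+[D+1]≡t*R+[1+R+1+t]) (≡.cong (c +_) D+1≡))

  weight-lower-bound : ∀ {q P w c D} → 2 ≤ q → 1 ≤ P →
    w * ((q ∸ 1) * (q ∸ 1)) + c * P ≡ c * (q * P) → c + D ≡ q * (q * P) →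
    D + 1 ≤ q * P + q → (q * P ∸ 1) * P ≤ w
  weight-lower-bound {suc (suc _)} {suc _} (s≤s (s≤s _)) (s≤s _) rows split =
    WeightArithmetic.R*P≤w rows split

  weight-exact : ∀ {q P w c D} → 2 ≤ q → 1 ≤ P →
    w * ((q ∸ 1) * (q ∸ 1)) + c * P ≡ c * (q * P) → c + D ≡ q * (q * P) →
    D + 1 ≡ q * P + q → w ≡ (q * P ∸ 1) * P
  weight-exact {suc (suc _)} {suc _} (s≤s (s≤s _)) (s≤s _) rows split D+1≡ =
    ≡.sym (WeightArithmetic.R*P≡w rows split D+1≡)

module Indicator where

  open import Data.Nat using (_+_; _*_)

  𝟙 : ∀ {a} {A : Set a} → Dec A → ℕ
  𝟙 (yes _) = 1
  𝟙 (no _)  = 0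

  module _ {a b} {A : Set a} {B : Set b} where

    𝟙-cong : (A → B) → (B → A) → (a? : Dec A) (b? : Dec B) → 𝟙 a? ≡ 𝟙 b?
    𝟙-cong _   _   (yes _) (yes _) = ≡.refl
    𝟙-cong A→B _   (yes x) (no ¬y) = ⊥-elim (¬y (A→B x))
    𝟙-cong _   B→A (no ¬x) (yes y) = ⊥-elim (¬x (B→A y))
    𝟙-cong _   _   (no _)  (no _)  = ≡.refl

    𝟙-mono : (A → B) → (a? : Dec A) (b? : Dec B) → 𝟙 a? ≤ 𝟙 b?
    𝟙-mono _   (yes _) (yes _) = ℕP.≤-refl
    𝟙-mono A→B (yes x) (no ¬y) = ⊥-elim (¬y (A→B x))
    𝟙-mono _   (no _)  _       = z≤n

    𝟙-× : (a? : Dec A) (b? : Dec B) → 𝟙 (a? ×-dec b?) ≡ 𝟙 a? * 𝟙 b?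
    𝟙-× (yes _) (yes _) = ≡.refl
    𝟙-× (yes _) (no _)  = ≡.refl
    𝟙-× (no _)  _       = ≡.refl

    𝟙-split : (a? : Dec A) (b? : Dec B) → 𝟙 a? ≡ 𝟙 (a? ×-dec b?) + 𝟙 (a? ×-dec ¬? b?)
    𝟙-split (yes _) (yes _) = ≡.refl
    𝟙-split (yes _) (no _)  = ≡.refl
    𝟙-split (no _)  _       = ≡.refl

    𝟙-⊎ : (a? : Dec A) (b? : Dec B) → 𝟙 (a? ⊎-dec b?) + 𝟙 (a? ×-dec b?) ≡ 𝟙 a? + 𝟙 b?
    𝟙-⊎ (yes _) (yes _) = ≡.refl
    𝟙-⊎ (yes _) (no _)  = ≡.refl
    𝟙-⊎ (no _)  (yes _) = ≡.refl
    𝟙-⊎ (no _)  (no _)  = ≡.refl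

  module _ {a} {A : Set a} where

    𝟙-yes : A → (a? : Dec A) → 𝟙 a? ≡ 1
    𝟙-yes _ (yes _) = ≡.refl
    𝟙-yes x (no ¬x) = ⊥-elim (¬x x)

    𝟙-no : ¬ A → (a? : Dec A) → 𝟙 a? ≡ 0
    𝟙-no ¬x (yes x) = ⊥-elim (¬x x)
    𝟙-no _  (no _)  = ≡.refl

  ∑-const : ∀ n x → sum {n} (λ _ → x) ≡ n * x
  ∑-const zero    x = ≡.refl
  ∑-const (suc n) x = ≡.cong (x +_) (∑-const n x)

  ∑≡0 : ∀ {n} {f : Fin n → ℕ} → (∀ i → f i ≡ 0) → sum f ≡ 0
  ∑≡0 {n} f≗0 = ≡.trans (ℕΣ.sum-cong-≗ f≗0) (≡.trans (∑-const n 0) (ℕP.*-zeroʳ n))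

  ∑-mono : ∀ {n} {f g : Fin n → ℕ} → (∀ i → f i ≤ g i) → sum f ≤ sum g
  ∑-mono {zero}  _   = z≤n
  ∑-mono {suc n} f≤g = ℕP.+-mono-≤ (f≤g zero) (∑-mono (λ i → f≤g (suc i)))

  ∑-𝟙-unique : ∀ {n p} {P : Fin n → Set p} (P? : ∀ i → Dec (P i)) (i : Fin n) →
    P i → (∀ j → P j → j ≡ i) → sum (λ j → 𝟙 (P? j)) ≡ 1
  ∑-𝟙-unique {suc n} P? i Pi unique = begin
    sum (λ j → 𝟙 (P? j))                                  ≡⟨ ℕΣ.sum-remove {i = i} (λ j → 𝟙 (P? j)) ⟩
    𝟙 (P? i) + sum (λ j → 𝟙 (P? (Fin.punchIn i j)))  ≡⟨ ≡.cong₂ _+_ (𝟙-yes Pi (P? i)) (∑≡0 others) ⟩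
    1                                                     ∎
    where
    open ≡.≡-Reasoning
    others : ∀ j → 𝟙 (P? (Fin.punchIn i j)) ≡ 0
    others j = 𝟙-no (λ p → FinP.punchInᵢ≢i i j (unique _ p)) (P? _)

module Position (n : ℕ) where

  open import Data.Nat using (_+_; _*_)
  open import Data.Fin using (remQuot; combine; cast)

  M : ℕ
  M = n * n + 2 * n

  private
    M≡ : M ≡ n + n * suc n
    M≡ = solve n
      where
      solve : ∀ n → n * n + 2 * n ≡ n + n * suc n
      solve = solve-∀

  -- suc M is (suc n) * (suc n) up to M≡, and position skips the index zero, which is (zero , zero).
  position : Fin M → Fin (suc n) × Fin (suc n)
  position t = remQuot (suc n) (suc (cast M≡ t))

  private
    combine-position : ∀ t → uncurry combine (position t) ≡ suc (cast M≡ t)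
    combine-position t = FinP.combine-remQuot {suc n} (suc n) _

  position-injective : ∀ {t u} → position t ≡ position u → t ≡ u
  position-injective {t} {u} eq = begin
    t                       ≡⟨ FinP.cast-involutive (≡.sym M≡) M≡ t ⟨
    cast _ (cast M≡ t)      ≡⟨ ≡.cong (cast (≡.sym M≡)) cast-t≡cast-u ⟩
    cast _ (cast M≡ u)      ≡⟨ FinP.cast-involutive (≡.sym M≡) M≡ u ⟩
    u                       ∎
    where
    open ≡.≡-Reasoning
    cast-t≡cast-u : cast M≡ t ≡ cast M≡ u
    cast-t≡cast-u = FinP.suc-injective
      (≡.trans (≡.sym (combine-position t)) (≡.trans (≡.cong (uncurry combine) eq) (combine-position u)))

  position≢00 : ∀ t → position t ≢ (zero , zero)
  position≢00 t eq with ≡.trans (≡.sym (combine-position t)) (≡.cong (uncurry combine) eq)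
  ... | ()

  position-surjective : ∀ i j → (i , j) ≢ (zero , zero) → Σ (Fin M) λ t → position t ≡ (i , j)
  position-surjective i j ij≢00 with combine i j in eq
  ... | zero  = ⊥-elim (ij≢00 (begin
    (i , j)                        ≡⟨ FinP.remQuot-combine i j ⟨
    remQuot (suc n) (combine i j)  ≡⟨ ≡.cong (remQuot (suc n)) eq ⟩
    remQuot (suc n) zero           ≡⟨ FinP.remQuot-combine {suc n} {suc n} zero zero ⟩
    (zero , zero)                  ∎))
    where open ≡.≡-Reasoning
  ... | suc c = cast (≡.sym M≡) c , (begin
    remQuot (suc n) (suc (cast M≡ (cast (≡.sym M≡) c)))  ≡⟨ ≡.cong (λ c → remQuot (suc n) (suc c)) (FinP.cast-involutive M≡ (≡.sym M≡) c) ⟩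
    remQuot (suc n) (suc c)                              ≡⟨ ≡.cong (remQuot (suc n)) eq ⟨
    remQuot (suc n) (combine i j)                        ≡⟨ FinP.remQuot-combine i j ⟩
    (i , j)                                              ∎)
    where open ≡.≡-Reasoning

open Arithmetic
open Indicator

module FiniteField {c ℓ} (F : CommutativeRing c ℓ) (isField : IsField F) {q : ℕ} (card : HasCard F q)
  (_≟_ : Decidable (CommutativeRing._≈_ F)) where

  open CommutativeRing F hiding (zero)
  open RingProperties ring using (-1*x≈-x; +-identityˡ-unique; -‿distribˡ-*; x∙y⁻¹≈ε⇒x≈y)
  open PointwiseEquality setoid using (_≋_; ≋-refl; ≋-reflexive; ≋-sym; ≋-trans)
  open SemiringSum semiring
    using (sum-syntax; sum-cong-≋; sum-replicate-zero; sum-remove; ∑-distrib-+; ∑-comm; *-distribˡ-sum; *-distribʳ-sum)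
  module ≈-Reasoning = SetoidReasoning setoid
  module +-CS = CommutativeSemigroupProperties +-commutativeSemigroup
  module *-CS = CommutativeSemigroupProperties *-commutativeSemigroup

  1≉0 : 1# ≉ 0#
  1≉0 = proj₁ isField

  inv : ∀ x → x ≉ 0# → Carrier
  inv x x≉0 = proj₁ (proj₂ isField x x≉0)

  inv-inverseʳ : ∀ {x} (x≉0 : x ≉ 0#) → x * inv x x≉0 ≈ 1#
  inv-inverseʳ {x} x≉0 = proj₂ (proj₂ isField x x≉0)

  inv-inverseˡ : ∀ {x} (x≉0 : x ≉ 0#) → inv x x≉0 * x ≈ 1#
  inv-inverseˡ x≉0 = trans (*-comm _ _) (inv-inverseʳ x≉0)

  inv-solve : ∀ {x a b} (x≉0 : x ≉ 0#) → x * a ≈ b → a ≈ inv x x≉0 * b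
  inv-solve {x} {a} {b} x≉0 xa≈b = begin
    a                   ≈⟨ *-identityˡ a ⟨
    1# * a              ≈⟨ *-congʳ (inv-inverseˡ x≉0) ⟨
    inv x x≉0 * x * a   ≈⟨ *-assoc _ _ _ ⟩
    inv x x≉0 * (x * a) ≈⟨ *-congˡ xa≈b ⟩
    inv x x≉0 * b       ∎
    where open ≈-Reasoning

  x*y≈0⇒y≈0 : ∀ {x y} → x ≉ 0# → x * y ≈ 0# → y ≈ 0#
  x*y≈0⇒y≈0 x≉0 xy≈0 = trans (inv-solve x≉0 xy≈0) (zeroʳ _)

  x*y≉0 : ∀ {x y} → x ≉ 0# → y ≉ 0# → x * y ≉ 0#
  x*y≉0 x≉0 y≉0 xy≈0 = y≉0 (x*y≈0⇒y≈0 x≉0 xy≈0)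

  inv≉0 : ∀ {x} (x≉0 : x ≉ 0#) → inv x x≉0 ≉ 0#
  inv≉0 x≉0 inv≈0 = 1≉0 (trans (sym (inv-inverseʳ x≉0)) (trans (*-congˡ inv≈0) (zeroʳ _)))

  -- Vectors, the pairing of functionals with vectors, and matrices

  F^_ : ℕ → Set c
  F^ m = Vect F m

  module _ {m : ℕ} where

    0ᵥ : F^ m
    0ᵥ _ = 0#

    _+ᵥ_ : F^ m → F^ m → F^ m
    (u +ᵥ v) i = u i + v i

    _·ᵥ_ : Carrier → F^ m → F^ m
    (a ·ᵥ v) i = a * v i

    -ᵥ_ : F^ m → F^ m
    -ᵥ v = (- 1#) ·ᵥ v

    unit : Fin m → F^ m
    unit i j with j Fin.≟ i
    ... | yes _ = 1#
    ... | no _  = 0#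

    unit-diag : ∀ i → unit i i ≈ 1#
    unit-diag i with i Fin.≟ i
    ... | yes _   = refl
    ... | no i≢i = ⊥-elim (i≢i ≡.refl)

    unit-off : ∀ {i j} → j ≢ i → unit i j ≈ 0#
    unit-off {i} {j} j≢i with j Fin.≟ i
    ... | yes j≡i = ⊥-elim (j≢i j≡i)
    ... | no _    = refl

    _≋?_ : Decidable (_≋_ {m})
    u ≋? v = FinP.all? (λ i → u i ≟ v i)

    zero? : U.Decidable (_≋ 0ᵥ)
    zero? = _≋? 0ᵥ

    infixl 6 _+ᵥ_
    infixr 7 _·ᵥ_
    infix 4 _≋?_

  Σᶠ≡∑ : ∀ {k} (f : F^ k) → Σᶠ F f ≡ ∑[ i < k ] f i
  Σᶠ≡∑ {zero}  f = ≡.refl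
  Σᶠ≡∑ {suc k} f = ≡.cong (f zero +_) (Σᶠ≡∑ (λ i → f (suc i)))

  ∑≈0 : ∀ {k} {f : F^ k} → f ≋ 0ᵥ → ∑[ i < k ] f i ≈ 0#
  ∑≈0 {k} f≈0 = trans (sum-cong-≋ f≈0) (sum-replicate-zero k)

  ∑-single : ∀ {k} {f : F^ k} i → (∀ j → j ≢ i → f j ≈ 0#) → ∑[ j < k ] f j ≈ f i
  ∑-single {suc k} {f} i others≈0 = begin
    ∑[ j < suc k ] f j                   ≈⟨ sum-remove {i = i} f ⟩
    f i + ∑[ j < k ] f (Fin.punchIn i j)  ≈⟨ +-congˡ (∑≈0 (λ j → others≈0 _ (FinP.punchInᵢ≢i i j))) ⟩
    f i + 0#                             ≈⟨ +-identityʳ _ ⟩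
    f i                                  ∎
    where open ≈-Reasoning

  ⟨_,_⟩ : ∀ {m} → F^ m → F^ m → Carrier
  ⟨_,_⟩ {m} ξ x = ∑[ i < m ] (ξ i * x i)

  module _ {m : ℕ} where

    eval≡⟨,⟩ : (ξ x : F^ m) → eval F ξ x ≡ ⟨ ξ , x ⟩
    eval≡⟨,⟩ ξ x = Σᶠ≡∑ (λ i → ξ i * x i)

    ⟨,⟩-cong : ∀ {ξ ξ′ x x′ : F^ m} → ξ ≋ ξ′ → x ≋ x′ → ⟨ ξ , x ⟩ ≈ ⟨ ξ′ , x′ ⟩
    ⟨,⟩-cong ξ≋ξ′ x≋x′ = sum-cong-≋ (λ i → *-cong (ξ≋ξ′ i) (x≋x′ i))

    ⟨,⟩-congʳ : ∀ (ξ : F^ m) {x x′} → x ≋ x′ → ⟨ ξ , x ⟩ ≈ ⟨ ξ , x′ ⟩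
    ⟨,⟩-congʳ ξ = ⟨,⟩-cong {ξ = ξ} ≋-refl

    ⟨,⟩-congˡ : ∀ (x : F^ m) {ξ ξ′} → ξ ≋ ξ′ → ⟨ ξ , x ⟩ ≈ ⟨ ξ′ , x ⟩
    ⟨,⟩-congˡ x ξ≋ξ′ = ⟨,⟩-cong ξ≋ξ′ (≋-refl {x = x})

    ⟨,⟩-comm : ∀ (ξ x : F^ m) → ⟨ ξ , x ⟩ ≈ ⟨ x , ξ ⟩
    ⟨,⟩-comm ξ x = sum-cong-≋ (λ i → *-comm (ξ i) (x i))

    ⟨,⟩-+ˡ : ∀ (ξ η x : F^ m) → ⟨ ξ +ᵥ η , x ⟩ ≈ ⟨ ξ , x ⟩ + ⟨ η , x ⟩
    ⟨,⟩-+ˡ ξ η x = trans (sum-cong-≋ (λ i → distribʳ (x i) (ξ i) (η i)))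
                         (∑-distrib-+ (λ i → ξ i * x i) (λ i → η i * x i))

    ⟨,⟩-+ʳ : ∀ (ξ x y : F^ m) → ⟨ ξ , x +ᵥ y ⟩ ≈ ⟨ ξ , x ⟩ + ⟨ ξ , y ⟩
    ⟨,⟩-+ʳ ξ x y = trans (sum-cong-≋ (λ i → distribˡ (ξ i) (x i) (y i)))
                         (∑-distrib-+ (λ i → ξ i * x i) (λ i → ξ i * y i))

    ⟨,⟩-·ˡ : ∀ a (ξ x : F^ m) → ⟨ a ·ᵥ ξ , x ⟩ ≈ a * ⟨ ξ , x ⟩
    ⟨,⟩-·ˡ a ξ x = trans (sum-cong-≋ (λ i → *-assoc a (ξ i) (x i)))
                         (sym (*-distribˡ-sum a (λ i → ξ i * x i)))

    ⟨,⟩-·ʳ : ∀ a (ξ x : F^ m) → ⟨ ξ , a ·ᵥ x ⟩ ≈ a * ⟨ ξ , x ⟩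
    ⟨,⟩-·ʳ a ξ x = trans (sum-cong-≋ (λ i → *-CS.x∙yz≈y∙xz (ξ i) a (x i)))
                         (sym (*-distribˡ-sum a (λ i → ξ i * x i)))

    ⟨,⟩-0ˡ : ∀ {ξ} (x : F^ m) → ξ ≋ 0ᵥ → ⟨ ξ , x ⟩ ≈ 0#
    ⟨,⟩-0ˡ x ξ≋0 = ∑≈0 (λ i → trans (*-congʳ (ξ≋0 i)) (zeroˡ (x i)))

    ⟨,⟩-0ʳ : ∀ (ξ : F^ m) {x} → x ≋ 0ᵥ → ⟨ ξ , x ⟩ ≈ 0#
    ⟨,⟩-0ʳ ξ x≋0 = ∑≈0 (λ i → trans (*-congˡ (x≋0 i)) (zeroʳ (ξ i)))

    ⟨unit,⟩ : ∀ i (x : F^ m) → ⟨ unit i , x ⟩ ≈ x i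
    ⟨unit,⟩ i x = trans (∑-single i (λ j j≢i → trans (*-congʳ (unit-off j≢i)) (zeroˡ (x j))))
                        (trans (*-congʳ (unit-diag i)) (*-identityˡ (x i)))

    ⟨,unit⟩ : ∀ (ξ : F^ m) i → ⟨ ξ , unit i ⟩ ≈ ξ i
    ⟨,unit⟩ ξ i = trans (∑-single i (λ j j≢i → trans (*-congˡ (unit-off j≢i)) (zeroʳ (ξ j))))
                        (trans (*-congˡ (unit-diag i)) (*-identityʳ (ξ i)))

    apply : Tens F m → F^ m → F^ m
    apply U x j = ⟨ (λ i → U i j) , x ⟩

    apply-cong : ∀ U {x y : F^ m} → x ≋ y → apply U x ≋ apply U y
    apply-cong U x≋y j = ⟨,⟩-cong ≋-refl x≋y

    apply-+ : ∀ U (x y : F^ m) → apply U (x +ᵥ y) ≋ apply U x +ᵥ apply U y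
    apply-+ U x y j = ⟨,⟩-+ʳ _ x y

    apply-· : ∀ U a (x : F^ m) → apply U (a ·ᵥ x) ≋ a ·ᵥ apply U x
    apply-· U a x j = ⟨,⟩-·ʳ a _ x

    apply-0 : ∀ U {x : F^ m} → x ≋ 0ᵥ → apply U x ≋ 0ᵥ
    apply-0 U x≋0 j = ⟨,⟩-0ʳ _ x≋0

    apply-⊗ : ∀ (a b v : F^ m) → apply (_⊗_ F a b) v ≋ ⟨ a , v ⟩ ·ᵥ b
    apply-⊗ a b v j = begin
      ∑[ i < m ] (a i * b j * v i)    ≈⟨ sum-cong-≋ (λ i → *-CS.xy∙z≈y∙xz (a i) (b j) (v i)) ⟩
      ∑[ i < m ] (b j * (a i * v i))  ≈⟨ *-distribˡ-sum (b j) (λ i → a i * v i) ⟨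
      b j * ⟨ a , v ⟩                 ≈⟨ *-comm (b j) _ ⟩
      ⟨ a , v ⟩ * b j                 ∎
      where open ≈-Reasoning

    ⟪_,_⟫ : Tens F m → Tens F m → Carrier
    ⟪ U , A ⟫ = ∑[ i < m ] ∑[ j < m ] (U i j * A i j)

    codeword≈⟪,⟫ : ∀ {N} (reps : Fin N → Tens F m) U k → codeword F reps U k ≈ ⟪ U , reps k ⟫
    codeword≈⟪,⟫ reps U k =
      trans (reflexive (Σᶠ≡∑ (λ i → Σᶠ F (λ j → U i j * reps k i j))))
            (sum-cong-≋ (λ i → reflexive (Σᶠ≡∑ (λ j → U i j * reps k i j))))

    ⟪,⟫-congˡ : ∀ {U V : Tens F m} A → _≈ₜ_ F U V → ⟪ U , A ⟫ ≈ ⟪ V , A ⟫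
    ⟪,⟫-congˡ A U≈V = sum-cong-≋ (λ i → sum-cong-≋ (λ j → *-congʳ (U≈V i j)))

    ⟪,⟫-congʳ : ∀ U {A B : Tens F m} → _≈ₜ_ F A B → ⟪ U , A ⟫ ≈ ⟪ U , B ⟫
    ⟪,⟫-congʳ U A≈B = sum-cong-≋ (λ i → sum-cong-≋ (λ j → *-congˡ (A≈B i j)))

    ⟪,⟫-·ʳ : ∀ U s (A : Tens F m) → ⟪ U , (λ i j → s * A i j) ⟫ ≈ s * ⟪ U , A ⟫
    ⟪,⟫-·ʳ U s A = begin
      ∑[ i < m ] ∑[ j < m ] (U i j * (s * A i j))
        ≈⟨ sum-cong-≋ (λ i → sum-cong-≋ (λ j → *-CS.x∙yz≈y∙xz (U i j) s (A i j))) ⟩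
      ∑[ i < m ] ∑[ j < m ] (s * (U i j * A i j))
        ≈⟨ sum-cong-≋ (λ i → *-distribˡ-sum s (λ j → U i j * A i j)) ⟨
      ∑[ i < m ] (s * ∑[ j < m ] (U i j * A i j))
        ≈⟨ *-distribˡ-sum s (λ i → ∑[ j < m ] (U i j * A i j)) ⟨
      s * ⟪ U , A ⟫ ∎
      where open ≈-Reasoning

    ⟪,⟫-⊗ : ∀ U (x ξ : F^ m) → ⟪ U , _⊗_ F x ξ ⟫ ≈ ⟨ ξ , apply U x ⟩
    ⟪,⟫-⊗ U x ξ = begin
      ∑[ i < m ] ∑[ j < m ] (U i j * (x i * ξ j))
        ≈⟨ sum-cong-≋ (λ i → sum-cong-≋ (λ j → *-CS.x∙yz≈z∙xy (U i j) (x i) (ξ j))) ⟩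
      ∑[ i < m ] ∑[ j < m ] (ξ j * (U i j * x i))
        ≈⟨ ∑-comm (λ i j → ξ j * (U i j * x i)) ⟩
      ∑[ j < m ] ∑[ i < m ] (ξ j * (U i j * x i))
        ≈⟨ sum-cong-≋ (λ j → *-distribˡ-sum (ξ j) (λ i → U i j * x i)) ⟨
      ⟨ ξ , apply U x ⟩ ∎
      where open ≈-Reasoning

  module _ {m : ℕ} where

    ⟪,⟫-+ˡ : ∀ (U V A : Tens F m) → ⟪ (λ i j → U i j + V i j) , A ⟫ ≈ ⟪ U , A ⟫ + ⟪ V , A ⟫
    ⟪,⟫-+ˡ U V A = trans (sum-cong-≋ (λ i → trans (sum-cong-≋ (λ j → distribʳ (A i j) (U i j) (V i j)))
                                                 (∑-distrib-+ (λ j → U i j * A i j) (λ j → V i j * A i j))))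
                         (∑-distrib-+ (λ i → ∑[ j < m ] (U i j * A i j)) (λ i → ∑[ j < m ] (V i j * A i j)))

    ⟪,⟫-·ˡ : ∀ s (U A : Tens F m) → ⟪ (λ i j → s * U i j) , A ⟫ ≈ s * ⟪ U , A ⟫
    ⟪,⟫-·ˡ s U A = trans (sum-cong-≋ (λ i → trans (sum-cong-≋ (λ j → *-assoc s (U i j) (A i j)))
                                                 (sym (*-distribˡ-sum s (λ j → U i j * A i j)))))
                         (sym (*-distribˡ-sum s (λ i → ∑[ j < m ] (U i j * A i j))))

    ∑-⟪,⟫ : ∀ {M} (a : Fin M → Carrier) (E : Fin M → Tens F m) A →
      ∑[ t < M ] (a t * ⟪ E t , A ⟫) ≈ ⟪ (λ i j → ∑[ t < M ] (a t * E t i j)) , A ⟫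
    ∑-⟪,⟫ {M} a E A = begin
      ∑[ t < M ] (a t * ⟪ E t , A ⟫)
        ≈⟨ sum-cong-≋ (λ t → ⟪,⟫-·ˡ (a t) (E t) A) ⟨
      ∑[ t < M ] ∑[ i < m ] ∑[ j < m ] (a t * E t i j * A i j)
        ≈⟨ ∑-comm (λ t i → ∑[ j < m ] (a t * E t i j * A i j)) ⟩
      ∑[ i < m ] ∑[ t < M ] ∑[ j < m ] (a t * E t i j * A i j)
        ≈⟨ sum-cong-≋ (λ i → ∑-comm (λ t j → a t * E t i j * A i j)) ⟩
      ∑[ i < m ] ∑[ j < m ] ∑[ t < M ] (a t * E t i j * A i j)
        ≈⟨ sum-cong-≋ (λ i → sum-cong-≋ (λ j → *-distribʳ-sum (A i j) (λ t → a t * E t i j))) ⟨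
      ⟪ (λ i j → ∑[ t < M ] (a t * E t i j)) , A ⟫ ∎
      where open ≈-Reasoning

    ⟪,unit⊗unit⟫ : ∀ (V : Tens F m) i j → ⟪ V , _⊗_ F (unit i) (unit j) ⟫ ≈ V i j
    ⟪,unit⊗unit⟫ V i j = trans (⟪,⟫-⊗ V (unit i) (unit j)) (trans (⟨unit,⟩ j _) (⟨,unit⟩ (λ l → V l j) i))

    unit⊗unit-off : ∀ {r s i j : Fin m} → (i , j) ≢ (r , s) → _⊗_ F (unit r) (unit s) i j ≈ 0#
    unit⊗unit-off {r} {s} {i} {j} ij≢rs with i Fin.≟ r | j Fin.≟ s
    ... | no _       | _          = zeroˡ _
    ... | yes _      | no _       = zeroʳ _
    ... | yes ≡.refl | yes ≡.refl = ⊥-elim (ij≢rs ≡.refl)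

    unit≉0 : ∀ (i : Fin m) → ¬ unit i ≋ 0ᵥ
    unit≉0 i unit≋0 = 1≉0 (trans (sym (unit-diag i)) (unit≋0 i))

  -- Counting in F^m

  [v-w]+w≋v : ∀ {m} (v w : F^ m) → (v +ᵥ -ᵥ w) +ᵥ w ≋ v
  [v-w]+w≋v v w i = trans (+-assoc _ _ _) (trans (+-congˡ -y+y≈0) (+-identityʳ (v i)))
    where
    -y+y≈0 : (- 1#) * w i + w i ≈ 0#
    -y+y≈0 = trans (+-congʳ (-1*x≈-x (w i))) (-‿inverseˡ (w i))

  [v+w]-w≋v : ∀ {m} (v w : F^ m) → (v +ᵥ w) +ᵥ -ᵥ w ≋ v
  [v+w]-w≋v v w i = trans (+-assoc _ _ _) (trans (+-congˡ y-y≈0) (+-identityʳ (v i)))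
    where
    y-y≈0 : w i + (- 1#) * w i ≈ 0#
    y-y≈0 = trans (+-congˡ (-1*x≈-x (w i))) (-‿inverseʳ (w i))

  private
    module Card = Inverse card

  enum : ∀ m → Fin (q ^ m) → F^ m
  enum zero    _ ()
  enum (suc m) i = Card.to (proj₁ a,j) ∷ enum m (proj₂ a,j)
    where
    a,j : Fin q × Fin (q ^ m)
    a,j = Fin.remQuot (q ^ m) i

  index : ∀ m → F^ m → Fin (q ^ m)
  index zero    _ = zero
  index (suc m) v = Fin.combine (Card.from (v zero)) (index m (tail v))

  enum-combine : ∀ m a j → enum (suc m) (Fin.combine a j) ≡ Card.to a ∷ enum m j
  enum-combine m a j = ≡.cong (λ (a , j) → Card.to a ∷ enum m j) (FinP.remQuot-combine a j)

  enum-index : ∀ m v → enum m (index m v) ≋ v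
  enum-index zero    v ()
  enum-index (suc m) v = ≋-trans (≋-reflexive (enum-combine m _ _)) head∷tail
    where
    head∷tail : Card.to (Card.from (v zero)) ∷ enum m (index m (tail v)) ≋ v
    head∷tail zero    = Card.strictlyInverseˡ (v zero)
    head∷tail (suc j) = enum-index m (tail v) j

  index-enum : ∀ m i → index m (enum m i) ≡ i
  index-enum zero    zero = ≡.refl
  index-enum (suc m) i    = ≡.trans
    (≡.cong₂ Fin.combine (Card.strictlyInverseʳ _) (index-enum m _)) (FinP.combine-remQuot {q} (q ^ m) i)

  index-cong : ∀ m {u v} → u ≋ v → index m u ≡ index m v
  index-cong zero    _   = ≡.refl
  index-cong (suc m) u≋v = ≡.cong₂ Fin.combine (Card.from-cong (u≋v zero)) (index-cong m (λ i → u≋v (suc i)))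

  ∑ᵥ : ∀ {m} → (F^ m → ℕ) → ℕ
  ∑ᵥ {m} g = sum (λ i → g (enum m i))

  module _ {m : ℕ} where

    ∑ᵥ-cong : ∀ {g h : F^ m → ℕ} → (∀ v → g v ≡ h v) → ∑ᵥ g ≡ ∑ᵥ h
    ∑ᵥ-cong g≗h = ℕΣ.sum-cong-≗ (λ i → g≗h (enum m i))

    ∑ᵥ-+ : ∀ (g h : F^ m → ℕ) → ∑ᵥ (λ v → g v ℕ.+ h v) ≡ ∑ᵥ g ℕ.+ ∑ᵥ h
    ∑ᵥ-+ g h = ℕΣ.∑-distrib-+ (λ i → g (enum m i)) (λ i → h (enum m i))

    ∑ᵥ-*ˡ : ∀ x (g : F^ m → ℕ) → x ℕ.* ∑ᵥ g ≡ ∑ᵥ (λ v → x ℕ.* g v)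
    ∑ᵥ-*ˡ x g = ℕΣ.*-distribˡ-sum x (λ i → g (enum m i))

    ∑ᵥ-*ʳ : ∀ x (g : F^ m → ℕ) → ∑ᵥ g ℕ.* x ≡ ∑ᵥ (λ v → g v ℕ.* x)
    ∑ᵥ-*ʳ x g = ℕΣ.*-distribʳ-sum x (λ i → g (enum m i))

    ∑ᵥ-const : ∀ x → ∑ᵥ {m} (λ _ → x) ≡ q ^ m ℕ.* x
    ∑ᵥ-const = ∑-const (q ^ m)

    ∑ᵥ-mono : ∀ {g h : F^ m → ℕ} → (∀ v → g v ≤ h v) → ∑ᵥ g ≤ ∑ᵥ h
    ∑ᵥ-mono g≤h = ∑-mono (λ i → g≤h (enum m i))

    ∑ᵥ-comm : ∀ {k} (g : F^ m → F^ k → ℕ) → ∑ᵥ (λ u → ∑ᵥ (g u)) ≡ ∑ᵥ (λ v → ∑ᵥ (λ u → g u v))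
    ∑ᵥ-comm {k} g = ℕΣ.∑-comm (λ i j → g (enum m i) (enum k j))

    ∑ᵥ-∑ : ∀ {N} (g : Fin N → F^ m → ℕ) → ∑ᵥ (λ v → sum (λ l → g l v)) ≡ sum (λ l → ∑ᵥ (g l))
    ∑ᵥ-∑ g = ℕΣ.∑-comm (λ i l → g l (enum m i))

    ∑ᵥ-translate : ∀ {g : F^ m → ℕ} → (∀ {u v} → u ≋ v → g u ≡ g v) → ∀ w →
      ∑ᵥ (λ v → g (v +ᵥ w)) ≡ ∑ᵥ g
    ∑ᵥ-translate {g} g-cong w = ≡.sym (≡.trans (ℕΣ.sum-permute (λ i → g (enum m i)) translation)
      (ℕΣ.sum-cong-≗ (λ i → g-cong (enum-index m (enum m i +ᵥ w)))))
      where
      shift : F^ m → Fin (q ^ m) → Fin (q ^ m)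
      shift w i = index m (enum m i +ᵥ w)
      shift-inverse : ∀ w i → shift w (shift (-ᵥ w) i) ≡ i
      shift-inverse w i = ≡.trans (index-cong m (λ j → trans (+-congʳ (enum-index m _ j)) ([v-w]+w≋v (enum m i) w j)))
                                  (index-enum m i)
      shift-inverse′ : ∀ w i → shift (-ᵥ w) (shift w i) ≡ i
      shift-inverse′ w i = ≡.trans (index-cong m (λ j → trans (+-congʳ (enum-index m _ j)) ([v+w]-w≋v (enum m i) w j)))
                                   (index-enum m i)
      translation : Permutation (q ^ m) (q ^ m)
      translation = permutation (shift w) (shift (-ᵥ w)) (shift-inverse w) (shift-inverse′ w)

  #_ : ∀ {m p} {P : Pred (F^ m) p} → U.Decidable P → ℕ
  # P? = ∑ᵥ (λ v → 𝟙 (P? v))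

  module _ {m : ℕ} {p r} {P : Pred (F^ m) p} {Q : Pred (F^ m) r} (P? : U.Decidable P) (Q? : U.Decidable Q) where

    #-cong : P ⊆ Q → Q ⊆ P → # P? ≡ # Q?
    #-cong P⊆Q Q⊆P = ∑ᵥ-cong (λ v → 𝟙-cong P⊆Q Q⊆P (P? v) (Q? v))

    #-mono : P ⊆ Q → # P? ≤ # Q?
    #-mono P⊆Q = ∑ᵥ-mono (λ v → 𝟙-mono P⊆Q (P? v) (Q? v))

    #-split : # P? ≡ # (P? ∩? Q?) ℕ.+ # (P? ∩? ∁? Q?)
    #-split = ≡.trans (∑ᵥ-cong (λ v → 𝟙-split (P? v) (Q? v)))
                      (∑ᵥ-+ (λ v → 𝟙 ((P? ∩? Q?) v)) (λ v → 𝟙 ((P? ∩? ∁? Q?) v)))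

    #-∪ : # (P? ∪? Q?) ℕ.+ # (P? ∩? Q?) ≡ # P? ℕ.+ # Q?
    #-∪ = ≡.trans (≡.sym (∑ᵥ-+ (λ v → 𝟙 ((P? ∪? Q?) v)) (λ v → 𝟙 ((P? ∩? Q?) v))))
            (≡.trans (∑ᵥ-cong (λ v → 𝟙-⊎ (P? v) (Q? v))) (∑ᵥ-+ (λ v → 𝟙 (P? v)) (λ v → 𝟙 (Q? v))))

  #₂ : ∀ {m p} {Q : F^ m → F^ m → Set p} → (∀ x → U.Decidable (Q x)) → ℕ
  #₂ Q? = ∑ᵥ (λ x → # (Q? x))

  module _ {m p r} {P : Pred (F^ m) p} {Q : Pred (F^ m) r} where

    #₂-product : (P? : U.Decidable P) (Q? : U.Decidable Q) → #₂ (λ x ξ → P? x ×-dec Q? ξ) ≡ # P? ℕ.* # Q?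
    #₂-product P? Q? = begin
      ∑ᵥ (λ x → ∑ᵥ (λ ξ → 𝟙 (P? x ×-dec Q? ξ)))
        ≡⟨ ∑ᵥ-cong (λ x → ∑ᵥ-cong (λ ξ → 𝟙-× (P? x) (Q? ξ))) ⟩
      ∑ᵥ (λ x → ∑ᵥ (λ ξ → 𝟙 (P? x) ℕ.* 𝟙 (Q? ξ)))
        ≡⟨ ∑ᵥ-cong (λ x → ∑ᵥ-*ˡ (𝟙 (P? x)) (λ ξ → 𝟙 (Q? ξ))) ⟨
      ∑ᵥ (λ x → 𝟙 (P? x) ℕ.* # Q?)
        ≡⟨ ∑ᵥ-*ʳ (# Q?) (λ x → 𝟙 (P? x)) ⟨
      # P? ℕ.* # Q? ∎
      where open ≡.≡-Reasoning

  #₂-∩-const : ∀ {m p r} {Q : F^ m → F^ m → Set p} {C : Set r} (Q? : ∀ x → U.Decidable (Q x)) (C? : Dec C) →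
    #₂ (λ x ξ → Q? x ξ ×-dec C?) ≡ #₂ Q? ℕ.* 𝟙 C?
  #₂-∩-const Q? C? = begin
    ∑ᵥ (λ x → ∑ᵥ (λ ξ → 𝟙 (Q? x ξ ×-dec C?)))
      ≡⟨ ∑ᵥ-cong (λ x → ∑ᵥ-cong (λ ξ → 𝟙-× (Q? x ξ) C?)) ⟩
    ∑ᵥ (λ x → ∑ᵥ (λ ξ → 𝟙 (Q? x ξ) ℕ.* 𝟙 C?))
      ≡⟨ ∑ᵥ-cong (λ x → ∑ᵥ-*ʳ (𝟙 C?) (λ ξ → 𝟙 (Q? x ξ))) ⟨
    ∑ᵥ (λ x → # (Q? x) ℕ.* 𝟙 C?)
      ≡⟨ ∑ᵥ-*ʳ (𝟙 C?) (λ x → # (Q? x)) ⟨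
    #₂ Q? ℕ.* 𝟙 C? ∎
    where open ≡.≡-Reasoning

  #-U : ∀ m → # (U? {A = F^ m}) ≡ q ^ m
  #-U m = ≡.trans (∑ᵥ-const {m} 1) (ℕP.*-identityʳ (q ^ m))

  #-singleton : ∀ {m} (w : F^ m) → # (_≋? w) ≡ 1
  #-singleton {m} w = ∑-𝟙-unique (λ i → enum m i ≋? w) (index m w) (enum-index m w)
    (λ i enum-i≋w → ≡.trans (≡.sym (index-enum m i)) (index-cong m enum-i≋w))

  #-complement : ∀ {m p} {P : Pred (F^ m) p} (P? : U.Decidable P) → # P? ℕ.+ # (∁? P?) ≡ q ^ m
  #-complement {m} P? = begin
    # P? ℕ.+ # (∁? P?)                        ≡⟨ ≡.cong₂ ℕ._+_ (#-cong P? (U? ∩? P?) (tt ,_) proj₂)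
                                                               (#-cong (∁? P?) (U? ∩? ∁? P?) (tt ,_) proj₂) ⟩
    # (U? ∩? P?) ℕ.+ # (U? ∩? ∁? P?)          ≡⟨ #-split U? P? ⟨
    # (U? {A = F^ m})                         ≡⟨ #-U m ⟩
    q ^ m                                     ∎
    where open ≡.≡-Reasoning

  ∃ᵥ? : ∀ {m p} {P : Pred (F^ m) p} → P Respects _≋_ → U.Decidable P → Dec (∃ P)
  ∃ᵥ? {m} P-resp P? with FinP.any? (λ i → P? (enum m i))
  ... | yes (i , Pi) = yes (enum m i , Pi)
  ... | no ∄i        = no (λ (v , Pv) → ∄i (index m v , P-resp (≋-sym (enum-index m v)) Pv))

  instance
    q-nonZero : NonZero q
    q-nonZero = ℕ.≢-nonZero (λ q≡0 → FinP.¬Fin0 (≡.subst Fin q≡0 (Card.from 0#)))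

  2≤q : 2 ≤ q
  2≤q = distinct⇒2≤ (Card.from 0#) (Card.from 1#) from0≢from1
    where
    from0≢from1 : Card.from 0# ≢ Card.from 1#
    from0≢from1 eq = 1≉0 (trans (sym (Card.strictlyInverseˡ 1#))
                        (trans (reflexive (≡.cong Card.to (≡.sym eq))) (Card.strictlyInverseˡ 0#)))
    distinct⇒2≤ : ∀ {k} (i j : Fin k) → i ≢ j → 2 ≤ k
    distinct⇒2≤ {suc zero}    zero zero i≢j = ⊥-elim (i≢j ≡.refl)
    distinct⇒2≤ {suc (suc _)} _    _    _   = s≤s (s≤s z≤n)

  nonZero? : ∀ {m} (x : F^ m) → Dec (NonZeroV F x)
  nonZero? x = FinP.any? (λ i → ¬? (x i ≟ 0#))

  ≉0⇒nonZero : ∀ {m} {x : F^ m} → ¬ x ≋ 0ᵥ → NonZeroV F x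
  ≉0⇒nonZero {x = x} x≉0 with nonZero? x
  ... | yes x≠0 = x≠0
  ... | no ∄i   = ⊥-elim (x≉0 (λ i → decidable-stable (x i ≟ 0#) (λ xi≉0 → ∄i (i , xi≉0))))

  -- Rank–nullity, lines and hyperplanes

  module RankNullity {a b p} {K : Pred (F^ a) p} (K? : U.Decidable K) (K-resp : K Respects _≋_)
    (K-+ : ∀ {u v} → K u → K v → K (u +ᵥ v)) (K-· : ∀ s {u} → K u → K (s ·ᵥ u))
    {f : F^ a → F^ b} (f-cong : ∀ {u v} → u ≋ v → f u ≋ f v)
    (f-+ : ∀ u v → f (u +ᵥ v) ≋ f u +ᵥ f v) where

    Image : Pred (F^ b) (c ⊔ ℓ ⊔ p)
    Image y = ∃ λ x → K x × f x ≋ y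

    image? : U.Decidable Image
    image? y = ∃ᵥ? (λ x≋x′ (Kx , fx≋y) → K-resp x≋x′ Kx , ≋-trans (≋-sym (f-cong x≋x′)) fx≋y)
                   (λ x → K? x ×-dec (f x ≋? y))

    fibre? : ∀ y → U.Decidable (λ x → K x × f x ≋ y)
    fibre? y x = K? x ×-dec (f x ≋? y)

    kernel? : U.Decidable (λ x → K x × f x ≋ 0ᵥ)
    kernel? = fibre? 0ᵥ

    -- A nonempty fibre is the kernel translated by any of its points.
    #-fibre : ∀ y → # (fibre? y) ≡ 𝟙 (image? y) ℕ.* # kernel?
    #-fibre y with image? y
    ... | no ∄x = ∑≡0 (λ i → 𝟙-no (λ (Kx , fx≋y) → ∄x (_ , Kx , fx≋y)) (fibre? y (enum a i)))
    ... | yes (x₀ , Kx₀ , fx₀≋y) = begin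
      # (fibre? y)
        ≡⟨ ∑ᵥ-translate fibre-cong x₀ ⟨
      ∑ᵥ (λ x → 𝟙 (fibre? y (x +ᵥ x₀)))
        ≡⟨ ∑ᵥ-cong (λ x → 𝟙-cong shifted⇒kernel kernel⇒shifted (fibre? y _) (kernel? x)) ⟩
      # kernel?
        ≡⟨ ℕP.*-identityˡ _ ⟨
      1 ℕ.* # kernel? ∎
      where
      open ≡.≡-Reasoning
      fibre-cong : ∀ {u v} → u ≋ v → 𝟙 (fibre? y u) ≡ 𝟙 (fibre? y v)
      fibre-cong u≋v = 𝟙-cong (λ (Ku , fu≋y) → K-resp u≋v Ku , ≋-trans (f-cong (≋-sym u≋v)) fu≋y)
                              (λ (Kv , fv≋y) → K-resp (≋-sym u≋v) Kv , ≋-trans (f-cong u≋v) fv≋y)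
                              (fibre? y _) (fibre? y _)
      shifted⇒kernel : ∀ {x} → K (x +ᵥ x₀) × f (x +ᵥ x₀) ≋ y → K x × f x ≋ 0ᵥ
      shifted⇒kernel {x} (K[x+x₀] , f[x+x₀]≋y) =
        K-resp ([v+w]-w≋v x x₀) (K-+ K[x+x₀] (K-· (- 1#) Kx₀)) ,
        λ i → +-identityˡ-unique _ _
                (trans (+-congˡ (sym (fx₀≋y i))) (trans (sym (f-+ x x₀ i)) (f[x+x₀]≋y i)))
      kernel⇒shifted : ∀ {x} → K x × f x ≋ 0ᵥ → K (x +ᵥ x₀) × f (x +ᵥ x₀) ≋ y
      kernel⇒shifted {x} (Kx , fx≋0) =
        K-+ Kx Kx₀ , λ i → trans (f-+ x x₀ i) (trans (+-cong (fx≋0 i) (fx₀≋y i)) (+-identityˡ (y i)))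

    #-kernel-image : # K? ≡ # kernel? ℕ.* # image?
    #-kernel-image = begin
      ∑ᵥ (λ x → 𝟙 (K? x))                                ≡⟨ ∑ᵥ-cong (λ x → ≡.sym (one-value x)) ⟩
      ∑ᵥ (λ x → ∑ᵥ (λ y → 𝟙 (fibre? y x)))                 ≡⟨ ∑ᵥ-comm (λ x y → 𝟙 (fibre? y x)) ⟩
      ∑ᵥ (λ y → # (fibre? y))                            ≡⟨ ∑ᵥ-cong #-fibre ⟩
      ∑ᵥ (λ y → 𝟙 (image? y) ℕ.* # kernel?)               ≡⟨ ∑ᵥ-*ʳ (# kernel?) (λ y → 𝟙 (image? y)) ⟨
      # image? ℕ.* # kernel?                              ≡⟨ ℕP.*-comm (# image?) _ ⟩
      # kernel? ℕ.* # image?                              ∎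
      where
      open ≡.≡-Reasoning
      one-value : ∀ x → ∑ᵥ (λ y → 𝟙 (fibre? y x)) ≡ 𝟙 (K? x)
      one-value x = begin
        ∑ᵥ (λ y → 𝟙 (K? x ×-dec (f x ≋? y)))
          ≡⟨ ∑ᵥ-cong (λ y → 𝟙-× (K? x) (f x ≋? y)) ⟩
        ∑ᵥ (λ y → 𝟙 (K? x) ℕ.* 𝟙 (f x ≋? y))
          ≡⟨ ∑ᵥ-*ˡ (𝟙 (K? x)) (λ y → 𝟙 (f x ≋? y)) ⟨
        𝟙 (K? x) ℕ.* ∑ᵥ (λ y → 𝟙 (f x ≋? y))
          ≡⟨ ≡.cong (𝟙 (K? x) ℕ.*_) (≡.trans (#-cong (f x ≋?_) (_≋? f x) ≋-sym ≋-sym)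
                                             (#-singleton (f x))) ⟩
        𝟙 (K? x) ℕ.* 1
          ≡⟨ ℕP.*-identityʳ _ ⟩
        𝟙 (K? x) ∎

  _∈⟨_⟩ : ∀ {m} → F^ m → F^ m → Set (c ⊔ ℓ)
  x ∈⟨ v ⟩ = ∃ λ a → x ≋ a ·ᵥ v

  line? : ∀ {m} (v : F^ m) → U.Decidable (_∈⟨ v ⟩)
  line? v x with FinP.any? (λ i → x ≋? Card.to i ·ᵥ v)
  ... | yes (i , x≋iv) = yes (Card.to i , x≋iv)
  ... | no ∄i          = no (λ (a , x≋av) → ∄i (Card.from a , λ j →
                                trans (x≋av j) (*-congʳ (sym (Card.strictlyInverseˡ a)))))

  annihilator? : ∀ {m} (x : F^ m) → U.Decidable (λ ξ → ⟨ ξ , x ⟩ ≈ 0#)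
  annihilator? x ξ = ⟨ ξ , x ⟩ ≟ 0#

  module _ {m} (x : F^ m) where

    annihilator-resp : (λ ξ → ⟨ ξ , x ⟩ ≈ 0#) Respects _≋_
    annihilator-resp ξ≋η ξx≈0 = trans (⟨,⟩-congˡ x (≋-sym ξ≋η)) ξx≈0

    annihilator-+ : ∀ {ξ η} → ⟨ ξ , x ⟩ ≈ 0# → ⟨ η , x ⟩ ≈ 0# → ⟨ ξ +ᵥ η , x ⟩ ≈ 0#
    annihilator-+ {ξ} {η} ξx≈0 ηx≈0 = trans (⟨,⟩-+ˡ ξ η x) (trans (+-cong ξx≈0 ηx≈0) (+-identityˡ 0#))

    annihilator-· : ∀ s {ξ} → ⟨ ξ , x ⟩ ≈ 0# → ⟨ s ·ᵥ ξ , x ⟩ ≈ 0#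
    annihilator-· s {ξ} ξx≈0 = trans (⟨,⟩-·ˡ s ξ x) (trans (*-congˡ ξx≈0) (zeroʳ s))

  #-without-0 : ∀ {m p} {P : Pred (F^ m) p} (P? : U.Decidable P) → P Respects _≋_ → P 0ᵥ →
    # (P? ∩? ∁? zero?) ℕ.+ 1 ≡ # P?
  #-without-0 {m} P? P-resp P0ᵥ = begin
    # (P? ∩? ∁? zero?) ℕ.+ 1                  ≡⟨ ℕP.+-comm (# (P? ∩? ∁? zero?)) 1 ⟩
    1 ℕ.+ # (P? ∩? ∁? zero?)                  ≡⟨ ≡.cong (ℕ._+ # (P? ∩? ∁? zero?)) zero-counts-once ⟨
    # (P? ∩? zero?) ℕ.+ # (P? ∩? ∁? zero?)    ≡⟨ #-split P? zero? ⟨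
    # P?                                      ∎
    where
    open ≡.≡-Reasoning
    zero-counts-once : # (P? ∩? zero?) ≡ 1
    zero-counts-once = ≡.trans (#-cong (P? ∩? zero?) zero? proj₂ (λ v≋0 → P-resp (≋-sym v≋0) P0ᵥ , v≋0))
                               (#-singleton {m} 0ᵥ)

  module _ {m p} {K : Pred (F^ m) p} (K? : U.Decidable K) (K-resp : K Respects _≋_)
    (K-+ : ∀ {u v} → K u → K v → K (u +ᵥ v)) (K-· : ∀ s {u} → K u → K (s ·ᵥ u)) where

    #-∩annihilator : ∀ {ξ₁ y} → K ξ₁ → ⟨ ξ₁ , y ⟩ ≉ 0# → # (K? ∩? annihilator? y) ℕ.* q ≡ # K?
    #-∩annihilator {ξ₁} {y} Kξ₁ ξ₁y≉0 = begin
      # (K? ∩? annihilator? y) ℕ.* q    ≡⟨ ≡.cong₂ ℕ._*_ kernel≡ image≡ ⟨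
      # kernel? ℕ.* # image?            ≡⟨ #-kernel-image ⟨
      # K?                              ∎
      where
      open ≡.≡-Reasoning
      evaluate : F^ m → F^ 1
      evaluate ξ _ = ⟨ ξ , y ⟩
      open RankNullity K? K-resp K-+ K-· {f = evaluate}
        (λ ξ≋ξ′ _ → ⟨,⟩-congˡ y ξ≋ξ′) (λ ξ η _ → ⟨,⟩-+ˡ ξ η y)
      s⁻¹ : Carrier
      s⁻¹ = inv ⟨ ξ₁ , y ⟩ ξ₁y≉0
      onto : ∀ t → Image t
      onto t = (t zero * s⁻¹) ·ᵥ ξ₁ , K-· _ Kξ₁ , λ { zero → hits (t zero) }
        where
        hits : ∀ a → ⟨ (a * s⁻¹) ·ᵥ ξ₁ , y ⟩ ≈ a
        hits a = trans (⟨,⟩-·ˡ _ ξ₁ y) (trans (*-assoc _ _ _)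
                   (trans (*-congˡ (inv-inverseˡ ξ₁y≉0)) (*-identityʳ a)))
      kernel≡ : # kernel? ≡ # (K? ∩? annihilator? y)
      kernel≡ = #-cong kernel? (K? ∩? annihilator? y) (λ (Kξ , ξy≈0) → Kξ , ξy≈0 zero)
                                                       (λ (Kξ , ξy≈0) → Kξ , λ { zero → ξy≈0 })
      image≡ : # image? ≡ q
      image≡ = ≡.trans (#-cong image? U? _ (λ {t} _ → onto t)) (≡.trans (#-U 1) (ℕP.*-identityʳ q))

  module _ {m : ℕ} where

    -- ξⱼ = xᵢ eⱼ - xⱼ eᵢ annihilates x; if all of them annihilate y, then y = (yᵢ / xᵢ) x.
    separating-functional : ∀ {x y : F^ m} → NonZeroV F x → ¬ y ∈⟨ x ⟩ →
      ∃ λ ξ → ⟨ ξ , x ⟩ ≈ 0# × ⟨ ξ , y ⟩ ≉ 0#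
    separating-functional {x} {y} (i , xi≉0) y∉⟨x⟩ = choose (FinP.any? (λ j → ¬? (minor y j ≟ 0#)))
      where
      minor : F^ m → Fin m → Carrier
      minor v j = x i * v j + (- x j) * v i
      ξ : Fin m → F^ m
      ξ j = x i ·ᵥ unit j +ᵥ (- x j) ·ᵥ unit i
      ⟨ξ,⟩ : ∀ j v → ⟨ ξ j , v ⟩ ≈ minor v j
      ⟨ξ,⟩ j v = trans (⟨,⟩-+ˡ _ _ v) (+-cong (trans (⟨,⟩-·ˡ _ _ v) (*-congˡ (⟨unit,⟩ j v)))
                                              (trans (⟨,⟩-·ˡ _ _ v) (*-congˡ (⟨unit,⟩ i v))))
      minor-self : ∀ j → minor x j ≈ 0#
      minor-self j = trans (+-congˡ (trans (sym (-‿distribˡ-* (x j) (x i))) (-‿cong (*-comm (x j) (x i)))))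
                           (-‿inverseʳ (x i * x j))
      proportional : (∀ j → minor y j ≈ 0#) → y ≋ (inv (x i) xi≉0 * y i) ·ᵥ x
      proportional minor≈0 j = begin
        y j
          ≈⟨ inv-solve xi≉0 (x∙y⁻¹≈ε⇒x≈y _ _ (trans (+-congˡ (-‿distribˡ-* _ _)) (minor≈0 j))) ⟩
        inv (x i) xi≉0 * (x j * y i)
          ≈⟨ *-CS.x∙yz≈xz∙y _ (x j) (y i) ⟩
        inv (x i) xi≉0 * y i * x j ∎
        where open ≈-Reasoning
      choose : Dec (∃ λ j → minor y j ≉ 0#) → ∃ λ ξ → ⟨ ξ , x ⟩ ≈ 0# × ⟨ ξ , y ⟩ ≉ 0#
      choose (yes (j , minor≉0)) =
        ξ j , trans (⟨ξ,⟩ j x) (minor-self j) , λ eq → minor≉0 (trans (sym (⟨ξ,⟩ j y)) eq)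
      choose (no ∄j) = ⊥-elim (y∉⟨x⟩ (_ , proportional (λ j →
        decidable-stable (minor y j ≟ 0#) (λ minor≉0 → ∄j (j , minor≉0)))))

    #-line : ∀ {v : F^ m} → NonZeroV F v → # (line? v) ≡ q
    #-line {v} (i , vi≉0) = ≡.sym (begin
      q                         ≡⟨ ≡.trans (#-U 1) (ℕP.*-identityʳ q) ⟨
      # (U? {A = F^ 1})         ≡⟨ #-kernel-image ⟩
      # kernel? ℕ.* # image?    ≡⟨ ≡.cong₂ ℕ._*_ kernel≡1 image≡line ⟩
      1 ℕ.* # (line? v)         ≡⟨ ℕP.*-identityˡ _ ⟩
      # (line? v)               ∎)
      where
      open ≡.≡-Reasoning
      scale : F^ 1 → F^ m
      scale t = t zero ·ᵥ v
      open RankNullity U? (λ _ _ → tt) (λ _ _ → tt) (λ _ _ → tt) {f = scale}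
        (λ t≋t′ j → *-congʳ (t≋t′ zero)) (λ t t′ j → distribʳ (v j) (t zero) (t′ zero))
      kernel≡1 : # kernel? ≡ 1
      kernel≡1 = ≡.trans (#-cong kernel? zero?
        (λ (_ , tv≋0) → λ { zero → x*y≈0⇒y≈0 vi≉0 (trans (*-comm _ _) (tv≋0 i)) })
        (λ t≋0 → tt , λ j → trans (*-congʳ (t≋0 zero)) (zeroˡ (v j)))) (#-singleton {1} 0ᵥ)
      image≡line : # image? ≡ # (line? v)
      image≡line = #-cong image? (line? v) (λ (t , _ , tv≋x) → t zero , ≋-sym tv≋x)
                                           (λ (a , x≋av) → (λ _ → a) , tt , ≋-sym x≋av)

  #-hyperplane : ∀ {n} {x : F^ suc n} → NonZeroV F x → # (annihilator? x) ≡ q ^ n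
  #-hyperplane {n} {x} (i , xi≉0) = ℕP.*-cancelʳ-≡ _ _ q (begin
    # (annihilator? x) ℕ.* q
      ≡⟨ ≡.cong (ℕ._* q) (#-cong (annihilator? x) (U? ∩? annihilator? x) (tt ,_) proj₂) ⟩
    # (U? ∩? annihilator? x) ℕ.* q
      ≡⟨ #-∩annihilator (U? {A = F^ suc n}) (λ _ _ → tt) (λ _ _ → tt) (λ _ _ → tt)
                        {unit i} {x} tt xᵢ≉0 ⟩
    # (U? {A = F^ suc n})
      ≡⟨ #-U (suc n) ⟩
    q ℕ.* q ^ n
      ≡⟨ ℕP.*-comm q (q ^ n) ⟩
    q ^ n ℕ.* q ∎)
    where
    open ≡.≡-Reasoning
    xᵢ≉0 : ⟨ unit i , x ⟩ ≉ 0#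
    xᵢ≉0 eq = xi≉0 (trans (sym (⟨unit,⟩ i x)) eq)

  #-hyperplane-pair : ∀ {n} {x y : F^ suc (suc n)} → NonZeroV F x → ¬ y ∈⟨ x ⟩ →
    # (annihilator? x ∩? annihilator? y) ≡ q ^ n
  #-hyperplane-pair {n} {x} {y} x≠0 y∉⟨x⟩ =
    let ξ , ξx≈0 , ξy≉0 = separating-functional x≠0 y∉⟨x⟩
    in ℕP.*-cancelʳ-≡ _ _ q (begin
      # (annihilator? x ∩? annihilator? y) ℕ.* q
        ≡⟨ #-∩annihilator (annihilator? x) (annihilator-resp x) (λ {u} {v} → annihilator-+ x {u} {v})
                          (annihilator-· x) {ξ} {y} ξx≈0 ξy≉0 ⟩
      # (annihilator? x)
        ≡⟨ #-hyperplane x≠0 ⟩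
      q ℕ.* q ^ n
        ≡⟨ ℕP.*-comm q (q ^ n) ⟩
      q ^ n ℕ.* q ∎)
    where open ≡.≡-Reasoning

  -- Vectors x with Ux ∈ ⟨ x ⟩

  Eigen : ∀ {m} → Tens F m → Pred (F^ m) (c ⊔ ℓ)
  Eigen U x = apply U x ∈⟨ x ⟩

  eigen? : ∀ {m} (U : Tens F m) → U.Decidable (Eigen U)
  eigen? U x = line? x (apply U x)

  -- On a flag (x , ξ) representing a point, the codeword of U is ξ(Ux) up to a nonzero scalar.
  InSupport : ∀ {m} → Tens F m → F^ m → Pred (F^ m) ℓ
  InSupport U x ξ = ⟨ ξ , x ⟩ ≈ 0# × ⟨ ξ , apply U x ⟩ ≉ 0#

  inSupport? : ∀ {m} (U : Tens F m) (x : F^ m) → U.Decidable (InSupport U x)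
  inSupport? U x = annihilator? x ∩? ∁? (annihilator? (apply U x))

  #support : ∀ {m} → Tens F m → ℕ
  #support U = ∑ᵥ (λ x → # (inSupport? U x))

  zero-eigen : ∀ {m} (U : Tens F m) {x} → x ≋ 0ᵥ → Eigen U x
  zero-eigen U {x} x≋0 = 0# , λ j → trans (apply-0 U x≋0 j) (sym (zeroˡ (x j)))

  module _ {k : ℕ} (U : Tens F (suc (suc k))) where

    #inSupport-eigen : ∀ {x} → Eigen U x → # (inSupport? U x) ≡ 0
    #inSupport-eigen {x} (c , Ux≋cx) =
      ∑≡0 (λ i → 𝟙-no (λ (ξx≈0 , ξUx≉0) → ξUx≉0 (vanishes (enum _ i) ξx≈0)) (inSupport? U x (enum _ i)))
      where
      vanishes : ∀ ξ → ⟨ ξ , x ⟩ ≈ 0# → ⟨ ξ , apply U x ⟩ ≈ 0#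
      vanishes ξ ξx≈0 = trans (⟨,⟩-congʳ ξ Ux≋cx) (trans (⟨,⟩-·ʳ c ξ x) (trans (*-congˡ ξx≈0) (zeroʳ c)))

    #inSupport-nonEigen : ∀ {x} → ¬ Eigen U x → # (inSupport? U x) ℕ.+ q ^ k ≡ q ^ suc k
    #inSupport-nonEigen {x} ¬eigen = begin
      # (inSupport? U x) ℕ.+ q ^ k
        ≡⟨ ≡.cong (# (inSupport? U x) ℕ.+_) (#-hyperplane-pair x≠0 ¬eigen) ⟨
      # (inSupport? U x) ℕ.+ # (annihilator? x ∩? annihilator? (apply U x))
        ≡⟨ ℕP.+-comm (# (inSupport? U x)) _ ⟩
      # (annihilator? x ∩? annihilator? (apply U x)) ℕ.+ # (inSupport? U x)
        ≡⟨ #-split (annihilator? x) (annihilator? (apply U x)) ⟨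
      # (annihilator? x)
        ≡⟨ #-hyperplane x≠0 ⟩
      q ^ suc k ∎
      where
      open ≡.≡-Reasoning
      x≠0 : NonZeroV F x
      x≠0 = ≉0⇒nonZero (λ x≋0 → ¬eigen (zero-eigen U x≋0))

    #support-rows : #support U ℕ.+ # (∁? (eigen? U)) ℕ.* q ^ k ≡ # (∁? (eigen? U)) ℕ.* q ^ suc k
    #support-rows = begin
      #support U ℕ.+ # (∁? (eigen? U)) ℕ.* q ^ k
        ≡⟨ ≡.cong (#support U ℕ.+_) (∑ᵥ-*ʳ (q ^ k) nonEigen) ⟩
      #support U ℕ.+ ∑ᵥ (λ x → 𝟙 (∁? (eigen? U) x) ℕ.* q ^ k)
        ≡⟨ ∑ᵥ-+ (λ x → # (inSupport? U x)) (λ x → nonEigen x ℕ.* q ^ k) ⟨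
      ∑ᵥ (λ x → # (inSupport? U x) ℕ.+ 𝟙 (∁? (eigen? U) x) ℕ.* q ^ k)
        ≡⟨ ∑ᵥ-cong (λ x → row x (eigen? U x)) ⟩
      ∑ᵥ (λ x → 𝟙 (∁? (eigen? U) x) ℕ.* q ^ suc k)
        ≡⟨ ∑ᵥ-*ʳ (q ^ suc k) nonEigen ⟨
      # (∁? (eigen? U)) ℕ.* q ^ suc k ∎
      where
      open ≡.≡-Reasoning
      nonEigen : F^ suc (suc k) → ℕ
      nonEigen x = 𝟙 (∁? (eigen? U) x)
      row : ∀ x (e? : Dec (Eigen U x)) → # (inSupport? U x) ℕ.+ 𝟙 (¬? e?) ℕ.* q ^ k ≡ 𝟙 (¬? e?) ℕ.* q ^ suc k
      row x (yes eigen)  = ≡.cong (ℕ._+ 0) (#inSupport-eigen eigen)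
      row x (no ¬eigen)  = ≡.trans (≡.cong (# (inSupport? U x) ℕ.+_) (ℕP.*-identityˡ (q ^ k)))
                                   (≡.trans (#inSupport-nonEigen ¬eigen) (≡.sym (ℕP.*-identityˡ _)))

  module _ {n : ℕ} (U : Tens F (suc n)) where

    eigen-resp : Eigen U Respects _≋_
    eigen-resp x≋y (c , Ux≋cx) = c , λ j →
      trans (apply-cong U (≋-sym x≋y) j) (trans (Ux≋cx j) (*-congˡ (x≋y j)))

    module Shift (λ₀ : Carrier) where

      shift : F^ suc n → F^ suc n
      shift x = apply U x +ᵥ (- λ₀) ·ᵥ x

      shift-cong : ∀ {x y} → x ≋ y → shift x ≋ shift y
      shift-cong x≋y j = +-cong (apply-cong U x≋y j) (*-congˡ (x≋y j))

      shift-+ : ∀ x y → shift (x +ᵥ y) ≋ shift x +ᵥ shift y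
      shift-+ x y j = trans (+-cong (apply-+ U x y j) (distribˡ (- λ₀) (x j) (y j))) (+-CS.interchange _ _ _ _)

      shift-· : ∀ s x → shift (s ·ᵥ x) ≋ s ·ᵥ shift x
      shift-· s x j = trans (+-cong (apply-· U s x j) (*-CS.x∙yz≈y∙xz (- λ₀) s (x j))) (sym (distribˡ s _ _))

      shift-eigen : ∀ {c x} → apply U x ≋ c ·ᵥ x → shift x ≋ (c - λ₀) ·ᵥ x
      shift-eigen {c} {x} Ux≋cx j = trans (+-congʳ (Ux≋cx j)) (sym (distribʳ (x j) c (- λ₀)))

      shift-0 : ∀ {x} → x ≋ 0ᵥ → shift x ≋ 0ᵥ
      shift-0 x≋0 j = trans (+-cong (apply-0 U x≋0 j) (trans (*-congˡ (x≋0 j)) (zeroʳ _))) (+-identityʳ 0#)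

      shift-kills-line : ∀ {v} → apply U v ≋ λ₀ ·ᵥ v → ∀ {x} → x ∈⟨ v ⟩ → shift x ≋ 0ᵥ
      shift-kills-line {v} Uv≋λ₀v {x} (t , x≋tv) j = begin
        shift x j              ≈⟨ shift-cong x≋tv j ⟩
        shift (t ·ᵥ v) j       ≈⟨ shift-· t v j ⟩
        t * shift v j          ≈⟨ *-congˡ (shift-eigen Uv≋λ₀v j) ⟩
        t * ((λ₀ - λ₀) * v j)  ≈⟨ *-congˡ (trans (*-congʳ (-‿inverseʳ λ₀)) (zeroˡ (v j))) ⟩
        t * 0#                 ≈⟨ zeroʳ t ⟩
        0#                     ∎
        where open ≈-Reasoning

      shift≋0⇒eigen : ∀ {x} → shift x ≋ 0ᵥ → Eigen U x
      shift≋0⇒eigen {x} shift≋0 = λ₀ , λ j →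
        x∙y⁻¹≈ε⇒x≈y _ _ (trans (+-congˡ (-‿distribˡ-* λ₀ (x j))) (shift≋0 j))

      eigen⇒kernel⊎image : ∀ {x} → Eigen U x → shift x ≋ 0ᵥ ⊎ ∃ λ y → shift y ≋ x
      eigen⇒kernel⊎image {x} (c , Ux≋cx) with (c - λ₀) ≟ 0#
      ... | yes c-λ₀≈0 = inj₁ (λ j → trans (shift-eigen Ux≋cx j) (trans (*-congʳ c-λ₀≈0) (zeroˡ (x j))))
      ... | no  c-λ₀≉0 = inj₂ (inv _ c-λ₀≉0 ·ᵥ x , λ j → begin
        shift (inv _ c-λ₀≉0 ·ᵥ x) j       ≈⟨ shift-· _ x j ⟩
        inv _ c-λ₀≉0 * shift x j          ≈⟨ *-congˡ (shift-eigen Ux≋cx j) ⟩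
        inv _ c-λ₀≉0 * ((c - λ₀) * x j)   ≈⟨ *-assoc _ _ _ ⟨
        inv _ c-λ₀≉0 * (c - λ₀) * x j     ≈⟨ *-congʳ (inv-inverseˡ c-λ₀≉0) ⟩
        1# * x j                          ≈⟨ *-identityˡ (x j) ⟩
        x j                               ∎)
        where open ≈-Reasoning

      -- Every x with Ux ∈ ⟨x⟩ lies in the kernel or the image of the shift; both contain a line
      -- and their sizes multiply to q^(n+1).
      #eigen+1≤ : ∀ {x₀ x₁} → ¬ x₀ ≋ 0ᵥ → apply U x₀ ≋ λ₀ ·ᵥ x₀ → ¬ Eigen U x₁ →
        # (eigen? U) ℕ.+ 1 ≤ q ^ n ℕ.+ q
      #eigen+1≤ {x₀} {x₁} x₀≉0 Ux₀≋λ₀x₀ ¬eigen₁ = begin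
        # (eigen? U) ℕ.+ 1
          ≤⟨ ℕP.+-mono-≤ (#-mono (eigen? U) (kernel? ∪? image?) eigen⊆kernel∪image) zero∈kernel∩image ⟩
        # (kernel? ∪? image?) ℕ.+ # (kernel? ∩? image?)
          ≡⟨ #-∪ kernel? image? ⟩
        # kernel? ℕ.+ # image?
          ≤⟨ m*n≡q*p⇒m+n≤p+q (ℕ.>-nonZero⁻¹ q) q≤kernel q≤image #kernel*#image≡q*q^n ⟩
        q ^ n ℕ.+ q ∎
        where
        open ℕP.≤-Reasoning
        open RankNullity (U? {A = F^ suc n}) (λ _ _ → tt) (λ _ _ → tt) (λ _ _ → tt) {f = shift} shift-cong shift-+
        eigen⊆kernel∪image : Eigen U ⊆ (λ x → (⊤ × shift x ≋ 0ᵥ) ⊎ Image x)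
        eigen⊆kernel∪image eigen with eigen⇒kernel⊎image eigen
        ... | inj₁ shift≋0    = inj₁ (tt , shift≋0)
        ... | inj₂ (y , sy≋x) = inj₂ (y , tt , sy≋x)
        zero∈kernel∩image : 1 ≤ # (kernel? ∩? image?)
        zero∈kernel∩image = ℕP.≤-trans (ℕP.≤-reflexive (≡.sym (#-singleton {suc n} 0ᵥ)))
          (#-mono zero? (kernel? ∩? image?)
            (λ x≋0 → (tt , shift-0 x≋0) , 0ᵥ , tt , ≋-trans (shift-0 (≋-refl {x = 0ᵥ})) (≋-sym x≋0)))
        q≤kernel : q ≤ # kernel?
        q≤kernel = ℕP.≤-trans (ℕP.≤-reflexive (≡.sym (#-line (≉0⇒nonZero x₀≉0))))
          (#-mono (line? x₀) kernel? (λ x∈⟨x₀⟩ → tt , shift-kills-line Ux₀≋λ₀x₀ x∈⟨x₀⟩))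
        #kernel*#image≡q*q^n : # kernel? ℕ.* # image? ≡ q ℕ.* q ^ n
        #kernel*#image≡q*q^n = ≡.trans (≡.sym #-kernel-image) (#-U (suc n))
        shift-x₁≉0 : ¬ shift x₁ ≋ 0ᵥ
        shift-x₁≉0 shift≋0 = ¬eigen₁ (shift≋0⇒eigen shift≋0)
        q≤image : q ≤ # image?
        q≤image = ℕP.≤-trans (ℕP.≤-reflexive (≡.sym (#-line (≉0⇒nonZero shift-x₁≉0))))
          (#-mono (line? (shift x₁)) image?
            (λ (t , y≋t·sx₁) → t ·ᵥ x₁ , tt , ≋-trans (shift-· t x₁) (≋-sym y≋t·sx₁)))

    Eigenvector : Pred (F^ suc n) (c ⊔ ℓ)
    Eigenvector x = ¬ x ≋ 0ᵥ × Eigen U x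

    eigenvector? : U.Decidable Eigenvector
    eigenvector? x = ¬? (x ≋? 0ᵥ) ×-dec eigen? U x

    eigenvector-resp : Eigenvector Respects _≋_
    eigenvector-resp x≋y (x≉0 , eigen) = (λ y≋0 → x≉0 (≋-trans x≋y y≋0)) , eigen-resp x≋y eigen

    #eigen≤1 : ¬ ∃ Eigenvector → # (eigen? U) ≤ 1
    #eigen≤1 ∄eigenvector = ℕP.≤-trans (#-mono (eigen? U) zero? only-zero) (ℕP.≤-reflexive (#-singleton {suc n} 0ᵥ))
      where
      only-zero : Eigen U ⊆ (_≋ 0ᵥ)
      only-zero {x} eigen = decidable-stable (x ≋? 0ᵥ) (λ x≉0 → ∄eigenvector (x , x≉0 , eigen))

    #eigen-bound : (∃ λ x → ¬ Eigen U x) → # (eigen? U) ℕ.+ 1 ≤ q ^ n ℕ.+ q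
    #eigen-bound (_ , ¬eigen₁) with ∃ᵥ? eigenvector-resp eigenvector?
    ... | yes (_ , x₀≉0 , λ₀ , Ux₀≋λ₀x₀) = Shift.#eigen+1≤ λ₀ x₀≉0 Ux₀≋λ₀x₀ ¬eigen₁
    ... | no ∄eigenvector = begin
      # (eigen? U) ℕ.+ 1  ≤⟨ ℕP.+-monoˡ-≤ 1 (#eigen≤1 ∄eigenvector) ⟩
      1 ℕ.+ 1             ≤⟨ ℕP.+-mono-≤ (ℕP.m^n>0 q n) (ℕ.>-nonZero⁻¹ q) ⟩
      q ^ n ℕ.+ q         ∎
      where open ℕP.≤-Reasoning

  module _ {m} {a : F^ m} (aa≉0 : ⟨ a , a ⟩ ≉ 0#) where

    private
      A : Tens F m
      A = _⊗_ F a a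

    rank-one-eigen⇒ : ∀ {x} → Eigen A x → ⟨ x , a ⟩ ≈ 0# ⊎ x ∈⟨ a ⟩
    rank-one-eigen⇒ {x} (c , Ax≋cx) with ⟨ a , x ⟩ ≟ 0#
    ... | yes ax≈0 = inj₁ (trans (⟨,⟩-comm x a) ax≈0)
    ... | no ax≉0  = inj₂ (inv c c≉0 * ⟨ a , x ⟩ , λ j →
          trans (inv-solve c≉0 (sym (ax·a≈cx j))) (sym (*-assoc _ _ _)))
      where
      ax·a≈cx : ∀ j → ⟨ a , x ⟩ * a j ≈ c * x j
      ax·a≈cx j = trans (sym (apply-⊗ a a x j)) (Ax≋cx j)
      c≉0 : c ≉ 0#
      c≉0 c≈0 = aa≉0 (⟨,⟩-0ˡ a (λ j → x*y≈0⇒y≈0 ax≉0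
                  (trans (ax·a≈cx j) (trans (*-congʳ c≈0) (zeroˡ (x j))))))

    rank-one-⇒eigen : ∀ {x} → ⟨ x , a ⟩ ≈ 0# ⊎ x ∈⟨ a ⟩ → Eigen A x
    rank-one-⇒eigen {x} (inj₁ xa≈0) = 0# , λ j → begin
      apply A x j       ≈⟨ apply-⊗ a a x j ⟩
      ⟨ a , x ⟩ * a j    ≈⟨ *-congʳ (trans (⟨,⟩-comm a x) xa≈0) ⟩
      0# * a j          ≈⟨ zeroˡ (a j) ⟩
      0#                ≈⟨ zeroˡ (x j) ⟨
      0# * x j          ∎
      where open ≈-Reasoning
    rank-one-⇒eigen {x} (inj₂ (t , x≋ta)) = ⟨ a , a ⟩ , λ j → begin
      apply A x j               ≈⟨ apply-⊗ a a x j ⟩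
      ⟨ a , x ⟩ * a j            ≈⟨ *-congʳ (trans (⟨,⟩-congʳ a x≋ta) (⟨,⟩-·ʳ t a a)) ⟩
      t * ⟨ a , a ⟩ * a j        ≈⟨ *-CS.xy∙z≈y∙xz t _ (a j) ⟩
      ⟨ a , a ⟩ * (t * a j)      ≈⟨ *-congˡ (x≋ta j) ⟨
      ⟨ a , a ⟩ * x j            ∎
      where open ≈-Reasoning

    rank-one-meet⇒0 : ∀ {x} → ⟨ x , a ⟩ ≈ 0# × x ∈⟨ a ⟩ → x ≋ 0ᵥ
    rank-one-meet⇒0 {x} (xa≈0 , t , x≋ta) j = trans (x≋ta j) (trans (*-congʳ t≈0) (zeroˡ (a j)))
      where
      t≈0 : t ≈ 0#
      t≈0 = x*y≈0⇒y≈0 aa≉0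
              (trans (*-comm _ t) (trans (sym (⟨,⟩-·ˡ t a a)) (trans (⟨,⟩-congˡ a (≋-sym x≋ta)) xa≈0)))

  #eigen-rank-one : ∀ {n} {a : F^ suc n} → ⟨ a , a ⟩ ≉ 0# → # (eigen? (_⊗_ F a a)) ℕ.+ 1 ≡ q ^ n ℕ.+ q
  #eigen-rank-one {n} {a} aa≉0 = begin
    # (eigen? (_⊗_ F a a)) ℕ.+ 1
      ≡⟨ ≡.cong₂ ℕ._+_ eigen≡ (≡.sym meet≡1) ⟩
    # (annihilator? a ∪? line? a) ℕ.+ # (annihilator? a ∩? line? a)
      ≡⟨ #-∪ (annihilator? a) (line? a) ⟩
    # (annihilator? a) ℕ.+ # (line? a)
      ≡⟨ ≡.cong₂ ℕ._+_ (#-hyperplane a≠0) (#-line a≠0) ⟩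
    q ^ n ℕ.+ q ∎
    where
    open ≡.≡-Reasoning
    a≠0 : NonZeroV F a
    a≠0 = ≉0⇒nonZero (λ a≋0 → aa≉0 (⟨,⟩-0ˡ a a≋0))
    eigen≡ : # (eigen? (_⊗_ F a a)) ≡ # (annihilator? a ∪? line? a)
    eigen≡ = #-cong (eigen? (_⊗_ F a a)) (annihilator? a ∪? line? a) (rank-one-eigen⇒ aa≉0) (rank-one-⇒eigen aa≉0)
    meet≡1 : # (annihilator? a ∩? line? a) ≡ 1
    meet≡1 = ≡.trans (#-cong (annihilator? a ∩? line? a) zero? (rank-one-meet⇒0 aa≉0)
      (λ x≋0 → ⟨,⟩-0ˡ a x≋0 , 0# , λ j → trans (x≋0 j) (sym (zeroˡ (a j))))) (#-singleton {suc n} 0ᵥ)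

  -- Flags

  Flag : ∀ {m} → F^ m → F^ m → Set ℓ
  Flag x ξ = ¬ x ≋ 0ᵥ × ¬ ξ ≋ 0ᵥ × ⟨ ξ , x ⟩ ≈ 0#

  flag? : ∀ {m} (x : F^ m) → U.Decidable (Flag x)
  flag? x ξ = ¬? (x ≋? 0ᵥ) ×-dec ¬? (ξ ≋? 0ᵥ) ×-dec annihilator? x ξ

  #-nonzero : ∀ m → # (∁? (zero? {m})) ≡ q ^ m ∸ 1
  #-nonzero m = m+1≡n⇒m≡n∸1 (begin
    # (∁? zeroₘ?) ℕ.+ 1             ≡⟨ ℕP.+-comm (# (∁? zeroₘ?)) 1 ⟩
    1 ℕ.+ # (∁? zeroₘ?)             ≡⟨ ≡.cong (ℕ._+ # (∁? zeroₘ?)) (#-singleton {m} 0ᵥ) ⟨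
    # zeroₘ? ℕ.+ # (∁? zeroₘ?)      ≡⟨ #-complement zeroₘ? ⟩
    q ^ m                           ∎)
    where
    open ≡.≡-Reasoning
    zeroₘ? : U.Decidable (_≋ 0ᵥ {m})
    zeroₘ? = zero?

  #-punctured-hyperplane : ∀ {n} {x : F^ suc n} → NonZeroV F x → # (annihilator? x ∩? ∁? zero?) ≡ q ^ n ∸ 1
  #-punctured-hyperplane {x = x} x≠0 = m+1≡n⇒m≡n∸1
    (≡.trans (#-without-0 (annihilator? x) (annihilator-resp x) (⟨,⟩-0ˡ x ≋-refl)) (#-hyperplane x≠0))

  #-punctured-line : ∀ {m} {v : F^ m} → NonZeroV F v → # (line? v ∩? ∁? zero?) ≡ q ∸ 1
  #-punctured-line {v = v} v≠0 = m+1≡n⇒m≡n∸1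
    (≡.trans (#-without-0 (line? v) (λ x≋y (a , x≋av) → a , ≋-trans (≋-sym x≋y) x≋av) (0# , λ j → sym (zeroˡ (v j))))
             (#-line v≠0))

  #₂-flag : ∀ {n} → #₂ (flag? {suc n}) ≡ (q ^ suc n ∸ 1) ℕ.* (q ^ n ∸ 1)
  #₂-flag {n} = begin
    ∑ᵥ {suc n} (λ x → # (flag? x))            ≡⟨ ∑ᵥ-cong (λ x → row x (x ≋? 0ᵥ)) ⟩
    ∑ᵥ (λ x → nonzero x ℕ.* (q ^ n ∸ 1))      ≡⟨ ∑ᵥ-*ʳ (q ^ n ∸ 1) nonzero ⟨
    # (∁? (zero? {suc n})) ℕ.* (q ^ n ∸ 1)    ≡⟨ ≡.cong (ℕ._* (q ^ n ∸ 1)) (#-nonzero (suc n)) ⟩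
    (q ^ suc n ∸ 1) ℕ.* (q ^ n ∸ 1)           ∎
    where
    open ≡.≡-Reasoning
    nonzero : F^ suc n → ℕ
    nonzero x = 𝟙 (¬? (x ≋? 0ᵥ))
    row : ∀ x (x≟0 : Dec (x ≋ 0ᵥ)) → # (flag? x) ≡ 𝟙 (¬? x≟0) ℕ.* (q ^ n ∸ 1)
    row x (yes x≋0) = ∑≡0 (λ i → 𝟙-no (λ (x≉0 , _) → x≉0 x≋0) (flag? x (enum _ i)))
    row x (no x≉0)  = begin
      # (flag? x)                      ≡⟨ #-cong (flag? x) (annihilator? x ∩? ∁? zero?)
                                                 (λ (_ , ξ≉0 , ξx≈0) → ξx≈0 , ξ≉0) (λ (ξx≈0 , ξ≉0) → x≉0 , ξ≉0 , ξx≈0) ⟩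
      # (annihilator? x ∩? ∁? zero?)   ≡⟨ #-punctured-hyperplane (≉0⇒nonZero x≉0) ⟩
      q ^ n ∸ 1                        ≡⟨ ℕP.*-identityˡ _ ⟨
      1 ℕ.* (q ^ n ∸ 1)                ∎

  ⊗-factor : ∀ {m} {x ξ y η : F^ m} {s} → s ≉ 0# → NonZeroV F y → NonZeroV F η →
    _≈ₜ_ F (_⊗_ F x ξ) (λ i j → s * _⊗_ F y η i j) → x ∈⟨ y ⟩
  ⊗-factor {x = x} {ξ} {y} {η} {s} s≉0 (i₀ , yi₀≉0) (j₀ , ηj₀≉0) x⊗ξ≈ =
    inv (ξ j₀) ξj₀≉0 * (s * η j₀) , λ i → begin
      x i                                     ≈⟨ inv-solve ξj₀≉0 (trans (*-comm _ _) (x⊗ξ≈ i j₀)) ⟩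
      inv (ξ j₀) ξj₀≉0 * (s * (y i * η j₀))   ≈⟨ *-congˡ (*-CS.x∙yz≈xz∙y s (y i) (η j₀)) ⟩
      inv (ξ j₀) ξj₀≉0 * (s * η j₀ * y i)     ≈⟨ *-assoc _ _ _ ⟨
      inv (ξ j₀) ξj₀≉0 * (s * η j₀) * y i     ∎
    where
    open ≈-Reasoning
    ξj₀≉0 : ξ j₀ ≉ 0#
    ξj₀≉0 ξj₀≈0 = x*y≉0 s≉0 (x*y≉0 yi₀≉0 ηj₀≉0)
      (trans (sym (x⊗ξ≈ i₀ j₀)) (trans (*-congˡ ξj₀≈0) (zeroʳ (x i₀))))

  module _ {n} {V : Tens F (suc n)} (V⊥flags : ∀ {x ξ} → Flag x ξ → ⟪ V , _⊗_ F x ξ ⟫ ≈ 0#) where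

    off-diagonal≈0 : ∀ {i j} → i ≢ j → V i j ≈ 0#
    off-diagonal≈0 {i} {j} i≢j = trans (sym (⟪,unit⊗unit⟫ V i j))
      (V⊥flags (unit≉0 i , unit≉0 j , trans (⟨unit,⟩ j (unit i)) (unit-off (λ j≡i → i≢j (≡.sym j≡i)))))

    -- (e₀ + eᵢ , e₀ - eᵢ) is a flag on which V pairs to V₀₀ - Vᵢᵢ.
    diagonal≈ : ∀ i → V i i ≈ V zero zero
    diagonal≈ zero    = refl
    diagonal≈ (suc i) = sym (x∙y⁻¹≈ε⇒x≈y _ _ (trans (sym ⟪V,x⊗ξ⟫≈) (V⊥flags (x≉0 , ξ≉0 , ⟨ξ,x⟩≈0))))
      where
      x ξ : F^ suc n
      x = unit zero +ᵥ unit (suc i)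
      ξ = unit zero +ᵥ -ᵥ unit (suc i)
      ⟨ξ,⟩ : ∀ v → ⟨ ξ , v ⟩ ≈ v zero - v (suc i)
      ⟨ξ,⟩ v = begin
        ⟨ ξ , v ⟩                                         ≈⟨ ⟨,⟩-+ˡ (unit zero) (-ᵥ unit (suc i)) v ⟩
        ⟨ unit zero , v ⟩ + ⟨ -ᵥ unit (suc i) , v ⟩        ≈⟨ +-congˡ (⟨,⟩-·ˡ (- 1#) (unit (suc i)) v) ⟩
        ⟨ unit zero , v ⟩ + - 1# * ⟨ unit (suc i) , v ⟩    ≈⟨ +-cong (⟨unit,⟩ zero v) (trans (-1*x≈-x _) (-‿cong (⟨unit,⟩ (suc i) v))) ⟩
        v zero - v (suc i)                                ∎
        where open ≈-Reasoning
      x₀≈1 : x zero ≈ 1#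
      x₀≈1 = trans (+-cong (unit-diag {suc n} zero) (unit-off {suc n} {suc i} {zero} (λ ()))) (+-identityʳ 1#)
      xᵢ≈1 : x (suc i) ≈ 1#
      xᵢ≈1 = trans (+-cong (unit-off {suc n} {zero} {suc i} (λ ())) (unit-diag (suc i))) (+-identityˡ 1#)
      x≉0 : ¬ x ≋ 0ᵥ
      x≉0 x≋0 = 1≉0 (trans (sym x₀≈1) (x≋0 zero))
      ξ≉0 : ¬ ξ ≋ 0ᵥ
      ξ≉0 ξ≋0 = 1≉0 (trans (sym ξ₀≈1) (ξ≋0 zero))
        where
        ξ₀≈1 : ξ zero ≈ 1#
        ξ₀≈1 = trans (+-cong (unit-diag {suc n} zero) (trans (*-congˡ (unit-off {suc n} {suc i} {zero} (λ ()))) (zeroʳ _)))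
                     (+-identityʳ 1#)
      ⟨ξ,x⟩≈0 : ⟨ ξ , x ⟩ ≈ 0#
      ⟨ξ,x⟩≈0 = trans (⟨ξ,⟩ x) (trans (+-cong x₀≈1 (-‿cong xᵢ≈1)) (-‿inverseʳ 1#))
      Vx : ∀ j → apply V x j ≈ V zero j + V (suc i) j
      Vx j = trans (apply-+ V (unit zero) (unit (suc i)) j)
                   (+-cong (⟨,unit⟩ (λ l → V l j) zero) (⟨,unit⟩ (λ l → V l j) (suc i)))
      ⟪V,x⊗ξ⟫≈ : ⟪ V , _⊗_ F x ξ ⟫ ≈ V zero zero - V (suc i) (suc i)
      ⟪V,x⊗ξ⟫≈ = trans (⟪,⟫-⊗ V x ξ) (trans (⟨ξ,⟩ (apply V x)) (+-cong
        (trans (Vx zero) (trans (+-congˡ (off-diagonal≈0 (λ ()))) (+-identityʳ _)))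
        (-‿cong (trans (Vx (suc i)) (trans (+-congʳ (off-diagonal≈0 (λ ()))) (+-identityˡ _))))))

    flags-annihilated⇒zero : V zero zero ≈ 0# → ∀ i j → V i j ≈ 0#
    flags-annihilated⇒zero V₀₀≈0 i j with i Fin.≟ j
    ... | yes ≡.refl = trans (diagonal≈ i) V₀₀≈0
    ... | no i≢j     = off-diagonal≈0 i≢j

  wt≡∑ : ∀ {N} (w : F^ N) → wt F _≟_ w ≡ sum (λ k → 𝟙 (¬? (w k ≟ 0#)))
  wt≡∑ {zero}  w = ≡.refl
  wt≡∑ {suc N} w with w zero ≟ 0#
  ... | yes _ = wt≡∑ (tail w)
  ... | no _  = ≡.cong suc (wt≡∑ (tail w))

  wt-cong : ∀ {N} {u v : F^ N} → u ≋ v → wt F _≟_ u ≡ wt F _≟_ v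
  wt-cong {u = u} {v} u≋v = ≡.trans (wt≡∑ u) (≡.trans (ℕΣ.sum-cong-≗ same-support) (≡.sym (wt≡∑ v)))
    where
    same-support : ∀ k → 𝟙 (¬? (u k ≟ 0#)) ≡ 𝟙 (¬? (v k ≟ 0#))
    same-support k = 𝟙-cong (λ uk≉0 vk≈0 → uk≉0 (trans (u≋v k) vk≈0)) (λ vk≉0 uk≈0 → vk≉0 (trans (sym (u≋v k)) uk≈0))
                            (¬? (u k ≟ 0#)) (¬? (v k ≟ 0#))

  nonZero⇒1≤wt : ∀ {N} {w : F^ N} → NonZeroV F w → 1 ≤ wt F _≟_ w
  nonZero⇒1≤wt {suc N} {w} (i , wi≉0) = begin
    1
      ≡⟨ 𝟙-yes wi≉0 (¬? (w i ≟ 0#)) ⟨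
    𝟙 (¬? (w i ≟ 0#))
      ≤⟨ ℕP.m≤m+n _ _ ⟩
    𝟙 (¬? (w i ≟ 0#)) ℕ.+ sum (λ j → 𝟙 (¬? (w (Fin.punchIn i j) ≟ 0#)))
      ≡⟨ ℕΣ.sum-remove {i = i} (λ j → 𝟙 (¬? (w j ≟ 0#))) ⟨
    sum (λ j → 𝟙 (¬? (w j ≟ 0#)))
      ≡⟨ wt≡∑ w ⟨
    wt F _≟_ w ∎
    where open ℕP.≤-Reasoning

  1≤wt⇒nonZero : ∀ {N} {w : F^ N} → 1 ≤ wt F _≟_ w → NonZeroV F w
  1≤wt⇒nonZero {w = w} 1≤wt = ≉0⇒nonZero (λ w≋0 → ℕP.<⇒≢ 1≤wt (≡.sym (≡.trans (wt≡∑ w)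
    (∑≡0 (λ k → 𝟙-no (λ wk≉0 → wk≉0 (w≋0 k)) (¬? (w k ≟ 0#)))))))

  -- The code of Λ₁

  module Λ₁ {n N : ℕ} (reps : Fin N → Tens F (suc n)) (isReps : IsRepsΛ₁ F reps) where

    private
      factorisation : ∀ k → InΛ₁ F (reps k)
      factorisation = proj₁ isReps

    x̂ ξ̂ : Fin N → F^ suc n
    x̂ k = proj₁ (factorisation k)
    ξ̂ k = proj₁ (proj₂ (factorisation k))

    x̂≠0 : ∀ k → NonZeroV F (x̂ k)
    x̂≠0 k = proj₁ (proj₂ (proj₂ (factorisation k)))

    ξ̂≠0 : ∀ k → NonZeroV F (ξ̂ k)
    ξ̂≠0 k = proj₁ (proj₂ (proj₂ (proj₂ (factorisation k))))

    ξ̂x̂≈0 : ∀ k → ⟨ ξ̂ k , x̂ k ⟩ ≈ 0#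
    ξ̂x̂≈0 k = trans (reflexive (≡.sym (eval≡⟨,⟩ (ξ̂ k) (x̂ k)))) (proj₁ (proj₂ (proj₂ (proj₂ (proj₂ (factorisation k))))))

    reps≈x̂⊗ξ̂ : ∀ k → _≈ₜ_ F (reps k) (_⊗_ F (x̂ k) (ξ̂ k))
    reps≈x̂⊗ξ̂ k = proj₂ (proj₂ (proj₂ (proj₂ (proj₂ (factorisation k)))))

    Represents : Fin N → F^ suc n → F^ suc n → Set (c ⊔ ℓ)
    Represents k x ξ = (x ∈⟨ x̂ k ⟩ × ¬ x ≋ 0ᵥ) × (ξ ∈⟨ ξ̂ k ⟩ × ¬ ξ ≋ 0ᵥ)

    represents? : ∀ k x → U.Decidable (Represents k x)
    represents? k x ξ = (line? (x̂ k) ∩? ∁? zero?) x ×-dec (line? (ξ̂ k) ∩? ∁? zero?) ξ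

    represents⇒scalar : ∀ {k x ξ} → Represents k x ξ →
      ∃ λ s → s ≉ 0# × _≈ₜ_ F (_⊗_ F x ξ) (λ i j → s * reps k i j)
    represents⇒scalar {k} (((a , x≋ax̂) , x≉0) , ((b , ξ≋bξ̂) , ξ≉0)) =
      a * b , x*y≉0 (nonzero-scalar x≋ax̂ x≉0) (nonzero-scalar ξ≋bξ̂ ξ≉0) ,
      λ i j → trans (*-cong (x≋ax̂ i) (ξ≋bξ̂ j)) (trans (*-CS.interchange a _ b _) (*-congˡ (sym (reps≈x̂⊗ξ̂ k i j))))
      where
      nonzero-scalar : ∀ {v w : F^ suc n} {t} → v ≋ t ·ᵥ w → ¬ v ≋ 0ᵥ → t ≉ 0#
      nonzero-scalar {w = w} v≋tw v≉0 t≈0 = v≉0 (λ j → trans (v≋tw j) (trans (*-congʳ t≈0) (zeroˡ (w j))))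

    represents⇒flag : ∀ {k x ξ} → Represents k x ξ → Flag x ξ
    represents⇒flag {k} {x} {ξ} (((a , x≋ax̂) , x≉0) , ((b , ξ≋bξ̂) , ξ≉0)) = x≉0 , ξ≉0 , (begin
      ⟨ ξ , x ⟩                    ≈⟨ ⟨,⟩-cong ξ≋bξ̂ x≋ax̂ ⟩
      ⟨ b ·ᵥ ξ̂ k , a ·ᵥ x̂ k ⟩      ≈⟨ ⟨,⟩-·ˡ b (ξ̂ k) (a ·ᵥ x̂ k) ⟩
      b * ⟨ ξ̂ k , a ·ᵥ x̂ k ⟩      ≈⟨ *-congˡ (⟨,⟩-·ʳ a (ξ̂ k) (x̂ k)) ⟩
      b * (a * ⟨ ξ̂ k , x̂ k ⟩)     ≈⟨ *-congˡ (trans (*-congˡ (ξ̂x̂≈0 k)) (zeroʳ a)) ⟩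
      b * 0#                      ≈⟨ zeroʳ b ⟩
      0#                          ∎)
      where open ≈-Reasoning

    flag⇒represents : ∀ {x ξ} → Flag x ξ → ∃ λ k → Represents k x ξ
    flag⇒represents {x} {ξ} (x≉0 , ξ≉0 , ξx≈0)
      with proj₂ (proj₂ isReps) (_⊗_ F x ξ)
             (x , ξ , ≉0⇒nonZero x≉0 , ≉0⇒nonZero ξ≉0 , trans (reflexive (eval≡⟨,⟩ ξ x)) ξx≈0 , λ _ _ → refl)
    ... | k , s , s≉0 , x⊗ξ≈s·reps =
      k , (⊗-factor s≉0 (x̂≠0 k) (ξ̂≠0 k) x⊗ξ≈s·x̂⊗ξ̂ , x≉0) , (⊗-factor s≉0 (ξ̂≠0 k) (x̂≠0 k) ξ⊗x≈s·ξ̂⊗x̂ , ξ≉0)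
      where
      x⊗ξ≈s·x̂⊗ξ̂ : _≈ₜ_ F (_⊗_ F x ξ) (λ i j → s * _⊗_ F (x̂ k) (ξ̂ k) i j)
      x⊗ξ≈s·x̂⊗ξ̂ i j = trans (x⊗ξ≈s·reps i j) (*-congˡ (reps≈x̂⊗ξ̂ k i j))
      ξ⊗x≈s·ξ̂⊗x̂ : _≈ₜ_ F (_⊗_ F ξ x) (λ j i → s * _⊗_ F (ξ̂ k) (x̂ k) j i)
      ξ⊗x≈s·ξ̂⊗x̂ j i = trans (*-comm _ _) (trans (x⊗ξ≈s·x̂⊗ξ̂ i j) (*-congˡ (*-comm _ _)))

    represents-unique : ∀ {k l x ξ} → Represents k x ξ → Represents l x ξ → k ≡ l
    represents-unique {k} {l} rk rl with k Fin.≟ l | represents⇒scalar rk | represents⇒scalar rl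
    ... | yes k≡l | _ | _ = k≡l
    ... | no k≢l | sₖ , sₖ≉0 , x⊗ξ≈sₖrepsₖ | sₗ , sₗ≉0 , x⊗ξ≈sₗrepsₗ =
      ⊥-elim (proj₁ (proj₂ isReps) k l k≢l (inv sₖ sₖ≉0 * sₗ , x*y≉0 (inv≉0 sₖ≉0) sₗ≉0 , λ i j →
        trans (inv-solve sₖ≉0 (trans (sym (x⊗ξ≈sₖrepsₖ i j)) (x⊗ξ≈sₗrepsₗ i j))) (sym (*-assoc _ _ _))))

    ∑-represents : ∀ {x ξ} → Flag x ξ → sum (λ k → 𝟙 (represents? k x ξ)) ≡ 1
    ∑-represents {x} {ξ} flag = ∑-𝟙-unique (λ l → represents? l x ξ) k rk (λ l rl → represents-unique rl rk)
      where
      k : Fin N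
      k = proj₁ (flag⇒represents flag)
      rk : Represents k x ξ
      rk = proj₂ (flag⇒represents flag)

    #₂-by-points : ∀ {p} {Q : F^ suc n → F^ suc n → Set p} (Q? : ∀ x → U.Decidable (Q x)) →
      (∀ {x ξ} → Q x ξ → Flag x ξ) → #₂ Q? ≡ sum (λ k → #₂ (λ x → Q? x ∩? represents? k x))
    #₂-by-points {Q = Q} Q? Q⇒flag = begin
      ∑ᵥ (λ x → ∑ᵥ (λ ξ → 𝟙 (Q? x ξ)))
        ≡⟨ ∑ᵥ-cong (λ x → ∑ᵥ-cong (λ ξ → split x ξ)) ⟩
      ∑ᵥ (λ x → ∑ᵥ (λ ξ → sum (λ k → 𝟙 ((Q? x ∩? represents? k x) ξ))))
        ≡⟨ ∑ᵥ-cong (λ x → ∑ᵥ-∑ (λ k ξ → 𝟙 ((Q? x ∩? represents? k x) ξ))) ⟩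
      ∑ᵥ (λ x → sum (λ k → # (Q? x ∩? represents? k x)))
        ≡⟨ ∑ᵥ-∑ (λ k x → # (Q? x ∩? represents? k x)) ⟩
      sum (λ k → #₂ (λ x → Q? x ∩? represents? k x)) ∎
      where
      open ≡.≡-Reasoning
      once : ∀ {x ξ} (Q?xξ : Dec (Q x ξ)) → 𝟙 Q?xξ ℕ.* sum (λ k → 𝟙 (represents? k x ξ)) ≡ 𝟙 Q?xξ
      once (yes Qxξ) = ≡.cong (1 ℕ.*_) (∑-represents (Q⇒flag Qxξ))
      once (no _)    = ≡.refl
      split : ∀ x ξ → 𝟙 (Q? x ξ) ≡ sum (λ k → 𝟙 ((Q? x ∩? represents? k x) ξ))
      split x ξ = begin
        𝟙 (Q? x ξ)
          ≡⟨ once (Q? x ξ) ⟨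
        𝟙 (Q? x ξ) ℕ.* sum (λ k → 𝟙 (represents? k x ξ))
          ≡⟨ ℕΣ.*-distribˡ-sum (𝟙 (Q? x ξ)) (λ k → 𝟙 (represents? k x ξ)) ⟩
        sum (λ k → 𝟙 (Q? x ξ) ℕ.* 𝟙 (represents? k x ξ))
          ≡⟨ ℕΣ.sum-cong-≗ (λ k → 𝟙-× (Q? x ξ) (represents? k x ξ)) ⟨
        sum (λ k → 𝟙 ((Q? x ∩? represents? k x) ξ)) ∎

    #₂-represents : ∀ k → #₂ (represents? k) ≡ (q ∸ 1) ℕ.* (q ∸ 1)
    #₂-represents k = ≡.trans (#₂-product (line? (x̂ k) ∩? ∁? zero?) (line? (ξ̂ k) ∩? ∁? zero?))
      (≡.cong₂ ℕ._*_ (#-punctured-line (x̂≠0 k)) (#-punctured-line (ξ̂≠0 k)))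

    N-formula : N ℕ.* ((q ∸ 1) ℕ.* (q ∸ 1)) ≡ (q ^ suc n ∸ 1) ℕ.* (q ^ n ∸ 1)
    N-formula = begin
      N ℕ.* ((q ∸ 1) ℕ.* (q ∸ 1))
        ≡⟨ ∑-const N ((q ∸ 1) ℕ.* (q ∸ 1)) ⟨
      sum {N} (λ k → (q ∸ 1) ℕ.* (q ∸ 1))
        ≡⟨ ℕΣ.sum-cong-≗ #₂-represents ⟨
      sum (λ k → #₂ (represents? k))
        ≡⟨ ℕΣ.sum-cong-≗ flags-representing ⟨
      sum (λ k → #₂ (λ x → flag? x ∩? represents? k x))
        ≡⟨ #₂-by-points (flag? {suc n}) (λ flag → flag) ⟨
      #₂ (flag? {suc n})
        ≡⟨ #₂-flag ⟩
      (q ^ suc n ∸ 1) ℕ.* (q ^ n ∸ 1) ∎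
      where
      open ≡.≡-Reasoning
      flags-representing : ∀ k → #₂ (λ x → flag? x ∩? represents? k x) ≡ #₂ (represents? k)
      flags-representing k = ∑ᵥ-cong (λ x →
        #-cong (flag? x ∩? represents? k x) (represents? k x) proj₂ (λ rk → represents⇒flag rk , rk))

    module _ (U : Tens F (suc n)) where

      private
        w : F^ N
        w = codeword F reps U

      represents⇒value : ∀ {k x ξ} → Represents k x ξ → ∃ λ s → s ≉ 0# × ⟨ ξ , apply U x ⟩ ≈ s * w k
      represents⇒value {k} {x} {ξ} rk =
        let s , s≉0 , x⊗ξ≈s·reps = represents⇒scalar rk
        in s , s≉0 , (begin
          ⟨ ξ , apply U x ⟩                 ≈⟨ ⟪,⟫-⊗ U x ξ ⟨
          ⟪ U , _⊗_ F x ξ ⟫                 ≈⟨ ⟪,⟫-congʳ U x⊗ξ≈s·reps ⟩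
          ⟪ U , (λ i j → s * reps k i j) ⟫  ≈⟨ ⟪,⟫-·ʳ U s (reps k) ⟩
          s * ⟪ U , reps k ⟫                ≈⟨ *-congˡ (codeword≈⟪,⟫ reps U k) ⟨
          s * w k                           ∎)
        where open ≈-Reasoning

      inSupport⇒flag : ∀ {x ξ} → InSupport U x ξ → Flag x ξ
      inSupport⇒flag {x} {ξ} (ξx≈0 , ξUx≉0) =
        (λ x≋0 → ξUx≉0 (⟨,⟩-0ʳ ξ (apply-0 U x≋0))) , (λ ξ≋0 → ξUx≉0 (⟨,⟩-0ˡ (apply U x) ξ≋0)) , ξx≈0

      #support≡weight : #support U ≡ wt F _≟_ w ℕ.* ((q ∸ 1) ℕ.* (q ∸ 1))
      #support≡weight = begin
        #₂ (inSupport? U)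
          ≡⟨ #₂-by-points (inSupport? U) inSupport⇒flag ⟩
        sum (λ k → #₂ (λ x → inSupport? U x ∩? represents? k x))
          ≡⟨ ℕΣ.sum-cong-≗ supported-representing ⟩
        sum (λ k → #₂ (λ x ξ → represents? k x ξ ×-dec ¬? (w k ≟ 0#)))
          ≡⟨ ℕΣ.sum-cong-≗ (λ k → #₂-∩-const (represents? k) (¬? (w k ≟ 0#))) ⟩
        sum (λ k → #₂ (represents? k) ℕ.* 𝟙 (¬? (w k ≟ 0#)))
          ≡⟨ ℕΣ.sum-cong-≗ (λ k → ≡.trans (≡.cong (ℕ._* 𝟙 (¬? (w k ≟ 0#))) (#₂-represents k))
                                          (ℕP.*-comm ((q ∸ 1) ℕ.* (q ∸ 1)) _)) ⟩
        sum (λ k → 𝟙 (¬? (w k ≟ 0#)) ℕ.* ((q ∸ 1) ℕ.* (q ∸ 1)))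
          ≡⟨ ℕΣ.*-distribʳ-sum ((q ∸ 1) ℕ.* (q ∸ 1)) (λ k → 𝟙 (¬? (w k ≟ 0#))) ⟨
        sum (λ k → 𝟙 (¬? (w k ≟ 0#))) ℕ.* ((q ∸ 1) ℕ.* (q ∸ 1))
          ≡⟨ ≡.cong (ℕ._* ((q ∸ 1) ℕ.* (q ∸ 1))) (wt≡∑ w) ⟨
        wt F _≟_ w ℕ.* ((q ∸ 1) ℕ.* (q ∸ 1)) ∎
        where
        open ≡.≡-Reasoning
        supported : ∀ k {x ξ} → InSupport U x ξ × Represents k x ξ → Represents k x ξ × w k ≉ 0#
        supported k ((_ , ξUx≉0) , rk) =
          let s , _ , ξUx≈s·wk = represents⇒value rk
          in rk , λ wk≈0 → ξUx≉0 (trans ξUx≈s·wk (trans (*-congˡ wk≈0) (zeroʳ s)))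
        supported⁻¹ : ∀ k {x ξ} → Represents k x ξ × w k ≉ 0# → InSupport U x ξ × Represents k x ξ
        supported⁻¹ k (rk , wk≉0) =
          let s , s≉0 , ξUx≈s·wk = represents⇒value rk
          in (proj₂ (proj₂ (represents⇒flag rk)) , λ ξUx≈0 → x*y≉0 s≉0 wk≉0 (trans (sym ξUx≈s·wk) ξUx≈0)) , rk
        supported-representing : ∀ k → #₂ (λ x → inSupport? U x ∩? represents? k x)
                                     ≡ #₂ (λ x ξ → represents? k x ξ ×-dec ¬? (w k ≟ 0#))
        supported-representing k = ∑ᵥ-cong (λ x → #-cong (inSupport? U x ∩? represents? k x)
          (λ ξ → represents? k x ξ ×-dec ¬? (w k ≟ 0#)) (supported k) (supported⁻¹ k))

    represents-annihilated⇒flags : ∀ {V} → (∀ k → ⟪ V , reps k ⟫ ≈ 0#) →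
      ∀ {x ξ} → Flag x ξ → ⟪ V , _⊗_ F x ξ ⟫ ≈ 0#
    represents-annihilated⇒flags {V} V⊥reps flag =
      let k , rk = flag⇒represents flag
          s , _ , x⊗ξ≈s·reps = represents⇒scalar rk
      in trans (⟪,⟫-congʳ V x⊗ξ≈s·reps) (trans (⟪,⟫-·ʳ V s (reps k)) (trans (*-congˡ (V⊥reps k)) (zeroʳ s)))

    open Position n

    -- The identity pairs to zero with every point of Λ₁, so the matrix units at all positions
    -- but (zero , zero) suffice.
    E : Fin M → Tens F (suc n)
    E t = _⊗_ F (unit (proj₁ (position t))) (unit (proj₂ (position t)))

    basis : Fin M → F^ N
    basis t = codeword F reps (E t)

    combination : (Fin M → Carrier) → Tens F (suc n)
    combination a i j = ∑[ t < M ] (a t * E t i j)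

    combination-at : ∀ a t → uncurry (combination a) (position t) ≈ a t
    combination-at a t = begin
      ∑[ u < M ] (a u * uncurry (E u) (position t))   ≈⟨ ∑-single t others≈0 ⟩
      a t * uncurry (E t) (position t)               ≈⟨ *-congˡ (*-cong (unit-diag i) (unit-diag j)) ⟩
      a t * (1# * 1#)                                ≈⟨ *-congˡ (*-identityʳ 1#) ⟩
      a t * 1#                                       ≈⟨ *-identityʳ (a t) ⟩
      a t                                            ∎
      where
      open ≈-Reasoning
      i j : Fin (suc n)
      i = proj₁ (position t)
      j = proj₂ (position t)
      others≈0 : ∀ u → u ≢ t → a u * uncurry (E u) (position t) ≈ 0#
      others≈0 u u≢t = trans (*-congˡ (unit⊗unit-off (λ eq → u≢t (position-injective (≡.sym eq))))) (zeroʳ (a u))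

    combination-00 : ∀ a → combination a zero zero ≈ 0#
    combination-00 a = ∑≈0 (λ t → trans (*-congˡ (unit⊗unit-off (λ eq → position≢00 t (≡.sym eq)))) (zeroʳ (a t)))

    lincomb≈⟪combination⟫ : ∀ a k → lincomb F a basis k ≈ ⟪ combination a , reps k ⟫
    lincomb≈⟪combination⟫ a k = trans (reflexive (Σᶠ≡∑ (λ t → a t * basis t k)))
      (trans (sum-cong-≋ (λ t → *-congˡ (codeword≈⟪,⟫ reps (E t) k))) (∑-⟪,⟫ a E (reps k)))

    independent : ∀ a → (∀ k → lincomb F a basis k ≈ 0#) → ∀ t → a t ≈ 0#
    independent a lincomb≈0 t = trans (sym (combination-at a t))
      (flags-annihilated⇒zero {V = combination a} (represents-annihilated⇒flags {combination a} ⟪combination,reps⟫≈0)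
        (combination-00 a) (proj₁ (position t)) (proj₂ (position t)))
      where
      ⟪combination,reps⟫≈0 : ∀ k → ⟪ combination a , reps k ⟫ ≈ 0#
      ⟪combination,reps⟫≈0 k = trans (sym (lincomb≈⟪combination⟫ a k)) (lincomb≈0 k)

    Id : Tens F (suc n)
    Id i j = unit j i

    ⟪Id,reps⟫≈0 : ∀ k → ⟪ Id , reps k ⟫ ≈ 0#
    ⟪Id,reps⟫≈0 k = begin
      ⟪ Id , reps k ⟫                      ≈⟨ ⟪,⟫-congʳ Id (reps≈x̂⊗ξ̂ k) ⟩
      ⟪ Id , _⊗_ F (x̂ k) (ξ̂ k) ⟫           ≈⟨ ⟪,⟫-⊗ Id (x̂ k) (ξ̂ k) ⟩
      ⟨ ξ̂ k , apply Id (x̂ k) ⟩             ≈⟨ ⟨,⟩-congʳ (ξ̂ k) (λ j → ⟨unit,⟩ j (x̂ k)) ⟩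
      ⟨ ξ̂ k , x̂ k ⟩                        ≈⟨ ξ̂x̂≈0 k ⟩
      0#                                   ∎
      where open ≈-Reasoning

    spanning : ∀ w → InCode F reps w → ∃ λ a → w ≋ lincomb F a basis
    spanning w (U , w≋cU) = a , λ k → begin
      w k
        ≈⟨ w≋cU k ⟩
      codeword F reps U k
        ≈⟨ codeword≈⟪,⟫ reps U k ⟩
      ⟪ U , reps k ⟫
        ≈⟨ +-identityʳ _ ⟨
      ⟪ U , reps k ⟫ + 0#
        ≈⟨ +-congˡ (trans (*-congˡ (⟪Id,reps⟫≈0 k)) (zeroʳ _)) ⟨
      ⟪ U , reps k ⟫ + - U zero zero * ⟪ Id , reps k ⟫
        ≈⟨ +-congˡ (⟪,⟫-·ˡ (- U zero zero) Id (reps k)) ⟨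
      ⟪ U , reps k ⟫ + ⟪ (λ i j → - U zero zero * Id i j) , reps k ⟫
        ≈⟨ ⟪,⟫-+ˡ U (λ i j → - U zero zero * Id i j) (reps k) ⟨
      ⟪ V , reps k ⟫
        ≈⟨ ⟪,⟫-congˡ (reps k) combination≈V ⟨
      ⟪ combination a , reps k ⟫
        ≈⟨ lincomb≈⟪combination⟫ a k ⟨
      lincomb F a basis k ∎
      where
      open ≈-Reasoning
      V : Tens F (suc n)
      V i j = U i j + - U zero zero * Id i j
      a : Fin M → Carrier
      a t = uncurry V (position t)
      away-from-00 : ∀ i j → (i , j) ≢ (zero , zero) → combination a i j ≈ V i j
      away-from-00 i j ij≢00 with position-surjective i j ij≢00
      ... | t , pos≡ij = ≡.subst (λ p → uncurry (combination a) p ≈ uncurry V p) pos≡ij (combination-at a t)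
      combination≈V : _≈ₜ_ F (combination a) V
      combination≈V zero    zero    = trans (combination-00 a) (sym (trans (+-congˡ (*-identityʳ _)) (-‿inverseʳ (U zero zero))))
      combination≈V zero    (suc j) = away-from-00 zero (suc j) (λ ())
      combination≈V (suc i) j       = away-from-00 (suc i) j (λ ())

    hasDim : HasDim F (InCode F reps) M
    hasDim = basis , (λ t → E t , λ k → refl) , independent , spanning

  module MinimumDistance {k N : ℕ} (reps : Fin N → Tens F (suc (suc k))) (isReps : IsRepsΛ₁ F reps) where

    open Λ₁ reps isReps

    module _ (U : Tens F (suc (suc k))) where

      private
        w #nonEigen : ℕ
        w = wt F _≟_ (codeword F reps U)
        #nonEigen = # (∁? (eigen? U))

      weight-rows : w ℕ.* ((q ∸ 1) ℕ.* (q ∸ 1)) ℕ.+ #nonEigen ℕ.* q ^ k ≡ #nonEigen ℕ.* q ^ suc k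
      weight-rows = ≡.subst (λ W → W ℕ.+ #nonEigen ℕ.* q ^ k ≡ #nonEigen ℕ.* q ^ suc k) (#support≡weight U) (#support-rows U)

      eigen-split : #nonEigen ℕ.+ # (eigen? U) ≡ q ^ suc (suc k)
      eigen-split = ≡.trans (ℕP.+-comm #nonEigen _) (#-complement (eigen? U))

      nonzero-weight⇒non-eigen : 1 ≤ w → ∃ λ x → ¬ Eigen U x
      nonzero-weight⇒non-eigen 1≤w with ∃ᵥ? (λ x≋y ¬eigen eigen → ¬eigen (eigen-resp U (≋-sym x≋y) eigen)) (∁? (eigen? U))
      ... | yes non-eigen = non-eigen
      ... | no ∄non-eigen = ⊥-elim (ℕP.<⇒≢ (ℕP.*-mono-≤ 1≤w 1≤[q∸1]²) (≡.sym (ℕP.m+n≡0⇒m≡0 _ rows₀)))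
        where
        #nonEigen≡0 : #nonEigen ≡ 0
        #nonEigen≡0 = ∑≡0 (λ i → 𝟙-no (λ ¬eigen → ∄non-eigen (_ , ¬eigen)) (∁? (eigen? U) (enum _ i)))
        rows₀ : w ℕ.* ((q ∸ 1) ℕ.* (q ∸ 1)) ℕ.+ 0 ≡ 0
        rows₀ = ≡.subst (λ c → w ℕ.* ((q ∸ 1) ℕ.* (q ∸ 1)) ℕ.+ c ℕ.* q ^ k ≡ c ℕ.* q ^ suc k) #nonEigen≡0 weight-rows
        1≤[q∸1]² : 1 ≤ (q ∸ 1) ℕ.* (q ∸ 1)
        1≤[q∸1]² = ℕP.*-mono-≤ (ℕP.∸-monoˡ-≤ 1 2≤q) (ℕP.∸-monoˡ-≤ 1 2≤q)

      weight-≥ : 1 ≤ w → (q ^ suc k ∸ 1) ℕ.* q ^ k ≤ w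
      weight-≥ 1≤w = weight-lower-bound 2≤q (ℕP.m^n>0 q k) weight-rows eigen-split
        (#eigen-bound U (nonzero-weight⇒non-eigen 1≤w))

    U₀ : Tens F (suc (suc k))
    U₀ = _⊗_ F (unit zero) (unit zero)

    weight-U₀ : wt F _≟_ (codeword F reps U₀) ≡ (q ^ suc k ∸ 1) ℕ.* q ^ k
    weight-U₀ = weight-exact 2≤q (ℕP.m^n>0 q k) (weight-rows U₀) (eigen-split U₀)
      (#eigen-rank-one (λ e₀e₀≈0 → 1≉0 (trans (sym (⟨unit,⟩ {suc (suc k)} zero (unit zero))) e₀e₀≈0)))

    hasMinDist : HasMinDist F _≟_ (InCode F reps) ((q ^ suc k ∸ 1) ℕ.* q ^ k)
    hasMinDist = (codeword F reps U₀ , (U₀ , λ _ → refl) , 1≤wt⇒nonZero 1≤weight-U₀ , weight-U₀) ,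
      λ w (U , w≋cU) w≠0 → ≡.subst ((q ^ suc k ∸ 1) ℕ.* q ^ k ≤_) (≡.sym (wt-cong w≋cU))
        (weight-≥ U (≡.subst (1 ≤_) (wt-cong w≋cU) (nonZero⇒1≤wt w≠0)))
      where
      1≤weight-U₀ : 1 ≤ wt F _≟_ (codeword F reps U₀)
      1≤weight-U₀ = ℕP.≤-trans (ℕP.*-mono-≤ 1≤q^[1+k]∸1 (ℕP.m^n>0 q k)) (ℕP.≤-reflexive (≡.sym weight-U₀))
        where
        1≤q^[1+k]∸1 : 1 ≤ q ^ suc k ∸ 1
        1≤q^[1+k]∸1 = ℕP.∸-monoˡ-≤ 1 (ℕP.≤-trans 2≤q (ℕP.m≤m*n q (q ^ k) ⦃ ℕP.m^n≢0 q k ⦄))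

open import Data.Nat using (_+_; _*_)

theorem1p1 : {c ℓ : Level} (q n : ℕ) → IsPrimePower q → 1 ≤ n →
    (F : CommutativeRing c ℓ) → IsField F → HasCard F q →
    (dec : Decidable (CommutativeRing._≈_ F)) →
    (N : ℕ) (reps : Fin N → Tens F (suc n)) → IsRepsΛ₁ F reps →
    (N * ((q ∸ 1) * (q ∸ 1)) ≡ (q ^ (suc n) ∸ 1) * (q ^ n ∸ 1))
    × HasDim F (InCode F reps) (n * n + 2 * n)
    × HasMinDist F dec (InCode F reps) (q ^ (2 * n ∸ 1) ∸ q ^ (n ∸ 1))
theorem1p1 q (suc k) _ _ F isField card dec N reps isReps =
  N-formula , hasDim ,
  ≡.subst (HasMinDist F dec (InCode F reps)) (≡.sym (q^[2n∸1]∸q^[n∸1]≡[q^n∸1]*q^[n∸1] q (suc k))) hasMinDist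
  where
  open FiniteField F isField card dec
  open Λ₁ reps isReps
  open MinimumDistance reps isReps
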